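{- Let $\mathcal{T}$ be a consistent typed combinatory algebra. The category $\mathbf{ApType}_{\mathcal{T}}$ of $\mathcal{T}$-apartness types is a well-pointed cartesian closed category with a natural numbers object, binary coproducts and a weak initial object.
   Context: A typed combinatory algebra (tca) $\mathcal{T}$ consists of a set of types containing distinguished types $\bot,\top,N$ and closed under binary operations $\times,\to,+$; for each type $T$ a set $|T|$; and total application maps $|S\to T|\times|S|\to|T|$, $(a,b)\mapsto ab$ (left associative), such that for all types $S,T,U$ there are elements $\mathsf{exf}\in|\bot\to S|$, $\mathsf{t}\in|\top|$, $\mathsf{k}\in|S\to T\to S|$, $\mathsf{s}\in|(S\to T\to U)\to(S\to T)\to(S\to U)|$, $\mathsf{pair}\in|S\to T\to S\times T|$, $\mathsf{fst}\in|S\times T\to S|$, $\mathsf{snd}\in|S\times T\to T|$, $\mathsf{inl}\in|S\to S+T|$, $\mathsf{inr}\in|T\to S+T|$, $\mathsf{case}\in|(S\to U)\to(T\to U)\to(S+T\to U)|$, $\mathsf{0}\in|N|$, $\mathsf{succ}\in|N\to N|$, $\mathsf{R}\in|S\to(N\to(S\to S))\to(N\to S)|$ satisfying $\mathsf{k}ab=a$, $\mathsf{s}abc=ac(bc)$, $\mathsf{fst}(\mathsf{pair}ab)=a$, $\mathsf{snd}(\mathsf{pair}ab)=b$, $\mathsf{case}ab(\mathsf{inl}x)=ax$, $\mathsf{case}ab(\mathsf{inr}x)=bx$, $\mathsf{R}ab\mathsf{0}=a$, $\mathsf{R}ab(\mathsf{succ}n)=bn(\mathsf{R}abn)$. $\mathcal{T}$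 is consistent if $\mathsf{0}\neq\mathsf{succ}\,\mathsf{0}$. A $\mathcal{T}$-apartness type is a tuple $(A,T_A,T_A^-,\#_A)$ of types $T_A,T_A^-$ with $|T_A^-|$ inhabited, an inhabited subset $A\subseteq|T_A|$, and a relation $\#_A\subseteq A\times A\times|T_A^-|$ (write $n:a_0\#_A a_1$) such that: there are no $a,n$ with $n:a\#_A a$; there is $s\in|T_A\to T_A\to T_A^-\to T_A^-|$ with $n:a_0\#_A a_1\Rightarrow s a_0a_1n:a_1\#_A a_0$; there is $t\in|T_A\to T_A\to T_A\to T_A^-\to(T_A^-+T_A^-)|$ such that if $n:a_0\#_A a_1$ and $a_2\in A$ then either $ta_0a_1a_2n=\mathsf{inl}\,m$ with $m:a_0\#_A a_2$ or $ta_0a_1a_2n=\mathsf{inr}\,m$ with $m:a_1\#_A a_2$. Write $a_0\sim_A a_1$ iff there is no $n$ with $n:a_0\#_A a_1$. A premorphism $\mathcal{A}\to\mathcal{B}$ is an $f\in|(T_A\to T_B)\times(T_A\to T_A\to T_B^-\to T_A^-)|$ with $(\mathsf{fst}f)a\in B$ for all $a\in A$ and such that $n:(\mathsf{fst}f)a_0\#_B(\mathsf{fst}f)a_1$ implies $(\mathsf{snd}f)a_0a_1n:a_0\#_A a_1$ for all $a_0,a_1\in A$; premorphisms $f,g$ are equivalent iff $(\mathsf{fst}f)a\sim_B(\mathsf{fst}g)a$ for all $a\in A$. $\mathbf{ApType}_{\mathcal{T}}$ is the category whose objects are $\mathcal T$-apartness types and whose morphisms are equivalence classes of premorphisms (with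 composition and identities induced by those of the combinatory algebra). -}

module Defs where

open import Level using (Level; _⊔_) renaming (suc to lsuc; zero to lzero)
open import Data.Product using (Σ; _×_; _,_; proj₁; proj₂; ∃)
open import Data.Sum using (_⊎_; inj₁; inj₂)
open import Data.Empty using (⊥)
open import Relation.Nullary using (¬_)
open import Relation.Binary.PropositionalEquality using (_≡_; refl; sym; trans; cong; cong₂; subst)
open import Relation.Binary.Structures using (IsEquivalence)

record TCA : Set₁ where
  infixr 5 _⇒_
  infixr 6 _×ᵗ_ _+ᵗ_
  infixl 9 _·_
  field
    Ty   : Set
    ⊥ᵗ   : Ty
    ⊤ᵗ   : Ty
    Nᵗ   : Ty
    _×ᵗ_ : Ty → Ty → Ty
    _⇒_  : Ty → Ty → Ty
    _+ᵗ_ : Ty → Ty → Ty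
    El   : Ty → Set
    _·_  : ∀ {S T} → El (S ⇒ T) → El S → El T
    exf  : ∀ {S} → El (⊥ᵗ ⇒ S)
    t    : El ⊤ᵗ
    k    : ∀ {S T} → El (S ⇒ T ⇒ S)
    s    : ∀ {S T U} → El ((S ⇒ T ⇒ U) ⇒ (S ⇒ T) ⇒ (S ⇒ U))
    pair : ∀ {S T} → El (S ⇒ T ⇒ S ×ᵗ T)
    fst  : ∀ {S T} → El (S ×ᵗ T ⇒ S)
    snd  : ∀ {S T} → El (S ×ᵗ T ⇒ T)
    inl  : ∀ {S T} → El (S ⇒ S +ᵗ T)
    inr  : ∀ {S T} → El (T ⇒ S +ᵗ T)
    case : ∀ {S T U} → El ((S ⇒ U) ⇒ (T ⇒ U) ⇒ (S +ᵗ T ⇒ U))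
    0ᶜ   : El Nᵗ
    succ : El (Nᵗ ⇒ Nᵗ)
    R    : ∀ {S} → El (S ⇒ (Nᵗ ⇒ (S ⇒ S)) ⇒ (Nᵗ ⇒ S))
    k-eq    : ∀ {S T} (a : El S) (b : El T) → k · a · b ≡ a
    s-eq    : ∀ {S T U} (a : El (S ⇒ T ⇒ U)) (b : El (S ⇒ T)) (c : El S) →
              s · a · b · c ≡ a · c · (b · c)
    fst-eq  : ∀ {S T} (a : El S) (b : El T) → fst · (pair · a · b) ≡ a
    snd-eq  : ∀ {S T} (a : El S) (b : El T) → snd · (pair · a · b) ≡ b
    inl-eq  : ∀ {S T U} (a : El (S ⇒ U)) (b : El (T ⇒ U)) (x : El S) →
              case · a · b · (inl · x) ≡ a · x
    inr-eq  : ∀ {S T U} (a : El (S ⇒ U)) (b : El (T ⇒ U)) (x : El T) →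
              case · a · b · (inr · x) ≡ b · x
    R0-eq   : ∀ {S} (a : El S) (b : El (Nᵗ ⇒ (S ⇒ S))) → R · a · b · 0ᶜ ≡ a
    RS-eq   : ∀ {S} (a : El S) (b : El (Nᵗ ⇒ (S ⇒ S))) (n : El Nᵗ) →
              R · a · b · (succ · n) ≡ b · n · (R · a · b · n)

Consistent : TCA → Set
Consistent 𝒯 = ¬ (0ᶜ ≡ succ · 0ᶜ)
  where open TCA 𝒯

-- Categories whose hom-sets carry an equivalence relation (setoid
-- enrichment); this is how a category whose morphisms are equivalence
-- classes is represented without quotient types.

record RawCat (o ℓ e : Level) : Set (lsuc (o ⊔ ℓ ⊔ e)) where
  infixr 9 _∘_
  infix 4 _≈_
  field
    Obj : Set o
    Hom : Obj → Obj → Set ℓ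
    _≈_ : ∀ {A B} → Hom A B → Hom A B → Set e
    id  : ∀ {A} → Hom A A
    _∘_ : ∀ {A B C} → Hom B C → Hom A B → Hom A C

module _ {o ℓ e : Level} (𝒞 : RawCat o ℓ e) where
  open RawCat 𝒞

  record IsCategory : Set (o ⊔ ℓ ⊔ e) where
    field
      ≈-equiv   : ∀ {A B} → IsEquivalence (_≈_ {A} {B})
      ∘-resp-≈  : ∀ {A B C} {f f′ : Hom B C} {g g′ : Hom A B} →
                  f ≈ f′ → g ≈ g′ → f ∘ g ≈ f′ ∘ g′
      assoc     : ∀ {A B C D} (f : Hom C D) (g : Hom B C) (h : Hom A B) →
                  (f ∘ g) ∘ h ≈ f ∘ (g ∘ h)
      identityˡ : ∀ {A B} (f : Hom A B) → id ∘ f ≈ f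
      identityʳ : ∀ {A B} (f : Hom A B) → f ∘ id ≈ f

  record Terminal : Set (o ⊔ ℓ ⊔ e) where
    field
      ⊤o      : Obj
      !       : ∀ {X} → Hom X ⊤o
      !-unique : ∀ {X} (f : Hom X ⊤o) → f ≈ !

  record Product (A B : Obj) : Set (o ⊔ ℓ ⊔ e) where
    field
      A×B    : Obj
      π₁     : Hom A×B A
      π₂     : Hom A×B B
      ⟨_,_⟩  : ∀ {X} → Hom X A → Hom X B → Hom X A×B
      π₁-β   : ∀ {X} (f : Hom X A) (g : Hom X B) → π₁ ∘ ⟨ f , g ⟩ ≈ f
      π₂-β   : ∀ {X} (f : Hom X A) (g : Hom X B) → π₂ ∘ ⟨ f , g ⟩ ≈ g
      unique : ∀ {X} (f : Hom X A) (g : Hom X B) (h : Hom X A×B) →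
               π₁ ∘ h ≈ f → π₂ ∘ h ≈ g → h ≈ ⟨ f , g ⟩

  BinaryProducts : Set (o ⊔ ℓ ⊔ e)
  BinaryProducts = ∀ A B → Product A B

  _×id[_] : ∀ {X Y} → Hom X Y → (P : BinaryProducts) → ∀ {A} →
            Hom (Product.A×B (P X A)) (Product.A×B (P Y A))
  _×id[_] {X} {Y} h P {A} =
    Product.⟨_,_⟩ (P Y A) (h ∘ Product.π₁ (P X A)) (Product.π₂ (P X A))

  record Exponential (P : BinaryProducts) (A B : Obj) : Set (o ⊔ ℓ ⊔ e) where
    field
      B^A    : Obj
      eval   : Hom (Product.A×B (P B^A A)) B
      curry  : ∀ {X} → Hom (Product.A×B (P X A)) B → Hom X B^A
      β      : ∀ {X} (f : Hom (Product.A×B (P X A)) B) →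
               eval ∘ (curry f ×id[ P ]) ≈ f
      unique : ∀ {X} (f : Hom (Product.A×B (P X A)) B) (h : Hom X B^A) →
               eval ∘ (h ×id[ P ]) ≈ f → h ≈ curry f

  record CartesianClosed : Set (o ⊔ ℓ ⊔ e) where
    field
      terminal     : Terminal
      products     : BinaryProducts
      exponentials : ∀ A B → Exponential products A B

  WellPointed : Terminal → Set (o ⊔ ℓ ⊔ e)
  WellPointed 𝟙 = ∀ {A B} (f g : Hom A B) →
    (∀ (x : Hom (Terminal.⊤o 𝟙) A) → f ∘ x ≈ g ∘ x) → f ≈ g

  record NNO (𝟙 : Terminal) : Set (o ⊔ ℓ ⊔ e) where
    open Terminal 𝟙
    field
      N      : Obj
      z      : Hom ⊤o N
      sc     : Hom N N
      iter   : ∀ {X} → Hom ⊤o X → Hom X X → Hom N X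
      iter-z : ∀ {X} (x : Hom ⊤o X) (f : Hom X X) → iter x f ∘ z ≈ x
      iter-s : ∀ {X} (x : Hom ⊤o X) (f : Hom X X) → iter x f ∘ sc ≈ f ∘ iter x f
      unique : ∀ {X} (x : Hom ⊤o X) (f : Hom X X) (u : Hom N X) →
               u ∘ z ≈ x → u ∘ sc ≈ f ∘ u → u ≈ iter x f

  record Coproduct (A B : Obj) : Set (o ⊔ ℓ ⊔ e) where
    field
      A+B    : Obj
      i₁     : Hom A A+B
      i₂     : Hom B A+B
      [_,_]  : ∀ {X} → Hom A X → Hom B X → Hom A+B X
      i₁-β   : ∀ {X} (f : Hom A X) (g : Hom B X) → [ f , g ] ∘ i₁ ≈ f
      i₂-β   : ∀ {X} (f : Hom A X) (g : Hom B X) → [ f , g ] ∘ i₂ ≈ g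
      unique : ∀ {X} (f : Hom A X) (g : Hom B X) (h : Hom A+B X) →
               h ∘ i₁ ≈ f → h ∘ i₂ ≈ g → h ≈ [ f , g ]

  BinaryCoproducts : Set (o ⊔ ℓ ⊔ e)
  BinaryCoproducts = ∀ A B → Coproduct A B

  record WeakInitial : Set (o ⊔ ℓ) where
    field
      ⊥o : Obj
      ¡  : ∀ X → Hom ⊥o X

module ApTypes (𝒯 : TCA) where
  open TCA 𝒯

  I : ∀ {S} → El (S ⇒ S)
  I {S} = s {S} {S ⇒ S} {S} · k · k

  I-eq : ∀ {S} (x : El S) → I · x ≡ x
  I-eq {S} x = trans (s-eq k k x) (k-eq x (k {S} {S} · x))

  B : ∀ {S T U} → El ((T ⇒ U) ⇒ (S ⇒ T) ⇒ S ⇒ U)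
  B = s · (k · s) · k

  B-eq : ∀ {S T U} (g : El (T ⇒ U)) (f : El (S ⇒ T)) (x : El S) →
         B · g · f · x ≡ g · (f · x)
  B-eq g f x = trans (cong (λ z → z · f · x) (trans (s-eq (k · s) k g)
                 (cong (_· (k · g)) (k-eq s g))))
               (trans (s-eq (k · g) f x) (cong (_· (f · x)) (k-eq g x)))

  record ApType : Set₁ where
    field
      T       : Ty
      T⁻      : Ty
      T⁻-inh  : El T⁻
      A       : El T → Set
      A-inh   : Σ (El T) A
      -- Ap a₀ a₁ n  means  n : a₀ #_A a₁
      Ap      : El T → El T → El T⁻ → Set
      Ap⊆A    : ∀ {a₀ a₁ n} → Ap a₀ a₁ n → A a₀ × A a₁
      irrefl  : ∀ a n → ¬ Ap a a n
      symm    : Σ (El (T ⇒ T ⇒ T⁻ ⇒ T⁻)) λ σ →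
                ∀ a₀ a₁ n → Ap a₀ a₁ n → Ap a₁ a₀ (σ · a₀ · a₁ · n)
      cotrans : Σ (El (T ⇒ T ⇒ T ⇒ T⁻ ⇒ (T⁻ +ᵗ T⁻))) λ τ →
                ∀ a₀ a₁ a₂ n → Ap a₀ a₁ n → A a₂ →
                (Σ (El T⁻) λ m → (τ · a₀ · a₁ · a₂ · n ≡ inl · m) × Ap a₀ a₂ m)
                ⊎ (Σ (El T⁻) λ m → (τ · a₀ · a₁ · a₂ · n ≡ inr · m) × Ap a₁ a₂ m)

    _∼_ : El T → El T → Set
    a₀ ∼ a₁ = ∀ n → ¬ Ap a₀ a₁ n

  open ApType

  record Premor (𝒜 ℬ : ApType) : Set where
    field
      mor  : El ((T 𝒜 ⇒ T ℬ) ×ᵗ (T 𝒜 ⇒ T 𝒜 ⇒ T⁻ ℬ ⇒ T⁻ 𝒜))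
      pres : ∀ a → A 𝒜 a → A ℬ (fst · mor · a)
      refl# : ∀ a₀ a₁ n → A 𝒜 a₀ → A 𝒜 a₁ →
              Ap ℬ (fst · mor · a₀) (fst · mor · a₁) n →
              Ap 𝒜 a₀ a₁ (snd · mor · a₀ · a₁ · n)

  open Premor

  _≈ᴾ_ : ∀ {𝒜 ℬ} → Premor 𝒜 ℬ → Premor 𝒜 ℬ → Set
  _≈ᴾ_ {𝒜} {ℬ} f g = ∀ a → A 𝒜 a → _∼_ ℬ (fst · mor f · a) (fst · mor g · a)

  -- identity premorphism: (λa.a, λa₀ a₁ n.n)
  idᴾ : ∀ {𝒜} → Premor 𝒜 𝒜
  idᴾ {𝒜} = record
    { mor  = pair · I · (k · (k · I))
    ; pres = λ a p → subst′ (A 𝒜) (sym (fst-id a)) p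
    ; refl# = λ a₀ a₁ n _ _ q →
        subst′ (Ap 𝒜 a₀ a₁) (sym (snd-id a₀ a₁ n))
          (subst′ (λ z → Ap 𝒜 z a₁ n) (fst-id a₀)
            (subst′ (λ z → Ap 𝒜 (fst · (pair · I · (k · (k · I))) · a₀) z n) (fst-id a₁) q)
          ) }
    where
    subst′ : ∀ {X : Set} (P : X → Set) {x y} → x ≡ y → P x → P y
    subst′ P refl p = p
    fst-id : ∀ a → fst · (pair · I · (k · (k · I))) · a ≡ a
    fst-id a = trans (cong (_· a) (fst-eq I (k · (k · I)))) (I-eq a)
    snd-id : ∀ a₀ a₁ n → snd · (pair · I · (k · (k · I))) · a₀ · a₁ · n ≡ n
    snd-id a₀ a₁ n =
      trans (cong (λ z → z · a₀ · a₁ · n) (snd-eq I (k · (k · I))))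
      (trans (cong (λ z → z · a₁ · n) (k-eq (k · I) a₀))
      (trans (cong (_· n) (k-eq I a₁)) (I-eq n)))

  -- λ a₀ a₁ n. sf a₀ a₁ (sg (ff a₀) (ff a₁) n), by bracket abstraction
  compSnd : ∀ {TA TB TA⁻ TB⁻ TC⁻} → El (TA ⇒ TA ⇒ TB⁻ ⇒ TA⁻) →
            El (TB ⇒ TB ⇒ TC⁻ ⇒ TB⁻) → El (TA ⇒ TB) →
            El (TA ⇒ TA ⇒ TC⁻ ⇒ TA⁻)
  compSnd sf sg ff = s · (B · s · (B · (B · B) · sf)) · (s · (B · B · (B · sg · ff)) · (k · ff))

  compSnd-eq : ∀ {TA TB TA⁻ TB⁻ TC⁻} (sf : El (TA ⇒ TA ⇒ TB⁻ ⇒ TA⁻))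
               (sg : El (TB ⇒ TB ⇒ TC⁻ ⇒ TB⁻)) (ff : El (TA ⇒ TB)) a₀ a₁ n →
               compSnd sf sg ff · a₀ · a₁ · n ≡ sf · a₀ · a₁ · (sg · (ff · a₀) · (ff · a₁) · n)
  compSnd-eq sf sg ff a₀ a₁ n =
    trans (cong (λ z → z · a₁ · n) L1)
    (trans (cong (_· n) L2) (B-eq (sf · a₀ · a₁) (sg · (ff · a₀) · (ff · a₁)) n))
    where
    L1 = trans (s-eq (B · s · (B · (B · B) · sf)) (s · (B · B · (B · sg · ff)) · (k · ff)) a₀)
         (cong₂ _·_
           (trans (B-eq s (B · (B · B) · sf) a₀) (cong (s ·_) (B-eq (B · B) sf a₀)))
           (trans (s-eq (B · B · (B · sg · ff)) (k · ff) a₀)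
             (trans (cong₂ _·_ (B-eq B (B · sg · ff) a₀) (k-eq ff a₀))
               (cong (λ z → B · z · ff) (B-eq sg ff a₀)))))
    L2 = trans (s-eq (B · B · (sf · a₀)) (B · (sg · (ff · a₀)) · ff) a₁)
         (cong₂ _·_ (B-eq B (sf · a₀) a₁) (B-eq (sg · (ff · a₀)) ff a₁))

  _∘ᴾ_ : ∀ {𝒜 ℬ 𝒞} → Premor ℬ 𝒞 → Premor 𝒜 ℬ → Premor 𝒜 𝒞
  _∘ᴾ_ {𝒜} {ℬ} {𝒞} g f = record
    { mor  = m
    ; pres = λ a p → subst (A 𝒞) (sym (fst-m a)) (pres g _ (pres f a p))
    ; refl# = λ a₀ a₁ n p₀ p₁ q →
        subst (Ap 𝒜 a₀ a₁) (sym (snd-m a₀ a₁ n))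
          (refl# f a₀ a₁ _ p₀ p₁
            (refl# g _ _ n (pres f a₀ p₀) (pres f a₁ p₁)
              (subst (λ z → Ap 𝒞 z (fst · mor g · (fst · mor f · a₁)) n) (fst-m a₀)
                (subst (λ z → Ap 𝒞 (fst · m · a₀) z n) (fst-m a₁) q)))) }
    where
    m = pair · (B · (fst · mor g) · (fst · mor f))
             · compSnd (snd · mor f) (snd · mor g) (fst · mor f)
    fst-m : ∀ a → fst · m · a ≡ fst · mor g · (fst · mor f · a)
    fst-m a = trans (cong (_· a) (fst-eq _ _)) (B-eq _ _ a)
    snd-m : ∀ a₀ a₁ n → snd · m · a₀ · a₁ · n ≡
            snd · mor f · a₀ · a₁ · (snd · mor g · (fst · mor f · a₀) · (fst · mor f · a₁) · n)
    snd-m a₀ a₁ n = trans (cong (λ z → z · a₀ · a₁ · n) (snd-eq _ _))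
                          (compSnd-eq (snd · mor f) (snd · mor g) (fst · mor f) a₀ a₁ n)

ApCat : TCA → RawCat (lsuc lzero) lzero lzero
ApCat 𝒯 = record
  { Obj = ApType
  ; Hom = Premor
  ; _≈_ = _≈ᴾ_
  ; id  = idᴾ
  ; _∘_ = _∘ᴾ_
  }
  where open ApTypes 𝒯

-- Each structure is built as in sets, with every map realised in 𝒯 together with a realiser
-- that pulls apartness witnesses of images back to witnesses of arguments. A pair is apart when
-- a component is, the witness being tagged with that component; the exponential consists of the
-- premorphisms themselves, apart when they are apart at some point; in the coproduct elements
-- of different summands are apart; and the natural numbers object consists of the numerals,
-- which 𝒯 can compare, consistency making distinct numerals distinct. Since morphisms are
-- compared only up to ∼, every universal property reduces to a pointwise computation.

module Submission where

open import Defs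
open import Data.Empty using (⊥; ⊥-elim)
open import Data.Nat using (ℕ; zero; suc)
open import Data.Nat.Properties using (suc-injective)
open import Data.Product using (Σ; _×_; _,_; proj₁; proj₂)
open import Data.Sum using (_⊎_; inj₁; inj₂)
open import Data.Unit using (tt) renaming (⊤ to Unit)
open import Relation.Nullary using (¬_)
open import Function using (_∘_)
open import Relation.Binary.PropositionalEquality
  using (_≡_; refl; sym; trans; cong; cong₂; subst; subst₂; module ≡-Reasoning)

module Combinators (𝒯 : TCA) where
  open TCA 𝒯
  open ApTypes 𝒯 using (I; I-eq)

  infixl 5 _▸_
  data Ctx : Set where
    ε   : Ctx
    _▸_ : Ctx → Ty → Ctx

  data Var : Ctx → Ty → Set where
    vz : ∀ {Γ S} → Var (Γ ▸ S) S
    vs : ∀ {Γ S U} → Var Γ S → Var (Γ ▸ U) S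

  infixl 8 _$_
  data Tm (Γ : Ctx) : Ty → Set where
    `_  : ∀ {S} → Var Γ S → Tm Γ S
    ⌜_⌝ : ∀ {S} → El S → Tm Γ S
    _$_ : ∀ {S U} → Tm Γ (S ⇒ U) → Tm Γ S → Tm Γ U

  Env : Ctx → Set
  Env ε       = Unit
  Env (Γ ▸ S) = Env Γ × El S

  lookup : ∀ {Γ S} → Var Γ S → Env Γ → El S
  lookup vz     (ρ , x) = x
  lookup (vs v) (ρ , x) = lookup v ρ

  ⟦_⟧ : ∀ {Γ S} → Tm Γ S → Env Γ → El S
  ⟦ ` v   ⟧ ρ = lookup v ρ
  ⟦ ⌜ a ⌝ ⟧ ρ = a
  ⟦ f $ a ⟧ ρ = ⟦ f ⟧ ρ · ⟦ a ⟧ ρ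

  -- Bracket abstraction. It is abstract so that ⟦ Λ u ⟧ ρ stays neutral: goals stay small and
  -- u and ρ can be inferred from such a term by unification.
  abstract
    Λ : ∀ {Γ S U} → Tm (Γ ▸ S) U → Tm Γ (S ⇒ U)
    Λ (` vz)     = ⌜ I ⌝
    Λ (` (vs v)) = ⌜ k ⌝ $ ` v
    Λ ⌜ a ⌝      = ⌜ k · a ⌝
    Λ (f $ a)    = ⌜ s ⌝ $ Λ f $ Λ a

    Λ-β : ∀ {Γ S U} (u : Tm (Γ ▸ S) U) (ρ : Env Γ) (x : El S) →
          ⟦ Λ u ⟧ ρ · x ≡ ⟦ u ⟧ (ρ , x)
    Λ-β (` vz)     ρ x = I-eq x
    Λ-β (` (vs v)) ρ x = k-eq _ x
    Λ-β ⌜ a ⌝      ρ x = k-eq a x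
    Λ-β (f $ a)    ρ x = trans (s-eq _ _ x) (cong₂ _·_ (Λ-β f ρ x) (Λ-β a ρ x))

  v0 : ∀ {Γ S} → Tm (Γ ▸ S) S
  v0 = ` vz
  v1 : ∀ {Γ S S₁} → Tm (Γ ▸ S ▸ S₁) S
  v1 = ` vs vz
  v2 : ∀ {Γ S S₁ S₂} → Tm (Γ ▸ S ▸ S₁ ▸ S₂) S
  v2 = ` vs (vs vz)
  v3 : ∀ {Γ S S₁ S₂ S₃} → Tm (Γ ▸ S ▸ S₁ ▸ S₂ ▸ S₃) S
  v3 = ` vs (vs (vs vz))
  v4 : ∀ {Γ S S₁ S₂ S₃ S₄} → Tm (Γ ▸ S ▸ S₁ ▸ S₂ ▸ S₃ ▸ S₄) S
  v4 = ` vs (vs (vs (vs vz)))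

  Λ₂ : ∀ {Γ S₁ S₂ U} → Tm (Γ ▸ S₁ ▸ S₂) U → Tm Γ (S₁ ⇒ S₂ ⇒ U)
  Λ₂ u = Λ (Λ u)

  Λ₃ : ∀ {Γ S₁ S₂ S₃ U} → Tm (Γ ▸ S₁ ▸ S₂ ▸ S₃) U → Tm Γ (S₁ ⇒ S₂ ⇒ S₃ ⇒ U)
  Λ₃ u = Λ (Λ₂ u)

  Λ₄ : ∀ {Γ S₁ S₂ S₃ S₄ U} → Tm (Γ ▸ S₁ ▸ S₂ ▸ S₃ ▸ S₄) U →
       Tm Γ (S₁ ⇒ S₂ ⇒ S₃ ⇒ S₄ ⇒ U)
  Λ₄ u = Λ (Λ₃ u)

  Λ₂-β : ∀ {Γ S₁ S₂ U} (u : Tm (Γ ▸ S₁ ▸ S₂) U) ρ x y →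
         ⟦ Λ₂ u ⟧ ρ · x · y ≡ ⟦ u ⟧ ((ρ , x) , y)
  Λ₂-β u ρ x y = trans (cong (_· y) (Λ-β (Λ u) ρ x)) (Λ-β u _ y)

  Λ₃-β : ∀ {Γ S₁ S₂ S₃ U} (u : Tm (Γ ▸ S₁ ▸ S₂ ▸ S₃) U) ρ x y z →
         ⟦ Λ₃ u ⟧ ρ · x · y · z ≡ ⟦ u ⟧ (((ρ , x) , y) , z)
  Λ₃-β u ρ x y z = trans (cong (_· z) (Λ₂-β (Λ u) ρ x y)) (Λ-β u _ z)

  Λ₄-β : ∀ {Γ S₁ S₂ S₃ S₄ U} (u : Tm (Γ ▸ S₁ ▸ S₂ ▸ S₃ ▸ S₄) U) ρ x y z w →
         ⟦ Λ₄ u ⟧ ρ · x · y · z · w ≡ ⟦ u ⟧ ((((ρ , x) , y) , z) , w)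
  Λ₄-β u ρ x y z w = trans (cong (_· w) (Λ₃-β (Λ u) ρ x y z)) (Λ-β u _ w)

  -- The shape of the cotransitivity clause of an apartness type.
  Tagged : ∀ {S S′} → El (S +ᵗ S′) → (El S → Set) → (El S′ → Set) → Set
  Tagged {S} {S′} d P Q = (Σ (El S) λ m → (d ≡ inl · m) × P m)
                        ⊎ (Σ (El S′) λ m → (d ≡ inr · m) × Q m)

  Tagged-map : ∀ {S S′} {v : El (S +ᵗ S′)} {P P′ Q Q′} →
               (∀ {m} → P m → P′ m) → (∀ {m} → Q m → Q′ m) → Tagged v P Q → Tagged v P′ Q′
  Tagged-map f g (inj₁ (m , e , p)) = inj₁ (m , e , f p)
  Tagged-map f g (inj₂ (m , e , q)) = inj₂ (m , e , g q)

  Tagged-≡ : ∀ {S S′} {v w : El (S +ᵗ S′)} {P Q} → v ≡ w → Tagged w P Q → Tagged v P Q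
  Tagged-≡ refl w-tagged = w-tagged

  inl-injective : ∀ {S U} {a a′ : El S} → inl {S} {U} · a ≡ inl · a′ → a ≡ a′
  inl-injective {a = a} {a′} e = begin
    a                               ≡⟨ sym (trans (inl-eq I (k · a) a) (I-eq a)) ⟩
    case · I · (k · a) · (inl · a)  ≡⟨ cong (case · I · (k · a) ·_) e ⟩
    case · I · (k · a) · (inl · a′) ≡⟨ trans (inl-eq I (k · a) a′) (I-eq a′) ⟩
    a′                              ∎
    where open ≡-Reasoning

  inr-injective : ∀ {S U} {b b′ : El U} → inr {S} {U} · b ≡ inr · b′ → b ≡ b′
  inr-injective {b = b} {b′} e = begin
    b                               ≡⟨ sym (trans (inr-eq (k · b) I b) (I-eq b)) ⟩
    case · (k · b) · I · (inr · b)  ≡⟨ cong (case · (k · b) · I ·_) e ⟩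
    case · (k · b) · I · (inr · b′) ≡⟨ trans (inr-eq (k · b) I b′) (I-eq b′) ⟩
    b′                              ∎
    where open ≡-Reasoning

  inl≢inr : Consistent 𝒯 → ∀ {S U} {a : El S} {b : El U} → ¬ (inl · a ≡ inr · b)
  inl≢inr consistent {a = a} {b} e = consistent (begin
    0ᶜ                                               ≡⟨ sym (k-eq 0ᶜ a) ⟩
    k · 0ᶜ · a                                       ≡⟨ sym (inl-eq _ (k · (succ · 0ᶜ)) a) ⟩
    case · (k · 0ᶜ) · (k · (succ · 0ᶜ)) · (inl · a)  ≡⟨ cong (case · (k · 0ᶜ) · (k · (succ · 0ᶜ)) ·_) e ⟩
    case · (k · 0ᶜ) · (k · (succ · 0ᶜ)) · (inr · b)  ≡⟨ inr-eq (k · 0ᶜ) _ b ⟩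
    k · (succ · 0ᶜ) · b                              ≡⟨ k-eq _ b ⟩
    succ · 0ᶜ                                        ∎)
    where open ≡-Reasoning

  caseᵗ : ∀ {Γ S S′ U} → Tm (Γ ▸ S) U → Tm (Γ ▸ S′) U → Tm Γ (S +ᵗ S′) → Tm Γ U
  caseᵗ f g d = ⌜ case ⌝ $ Λ f $ Λ g $ d

  caseᵗ-inl : ∀ {Γ S S′ U} {f : Tm (Γ ▸ S) U} {g : Tm (Γ ▸ S′) U} {ρ m} →
              case · ⟦ Λ f ⟧ ρ · ⟦ Λ g ⟧ ρ · (inl · m) ≡ ⟦ f ⟧ (ρ , m)
  caseᵗ-inl {f = f} {g} {ρ} {m} = trans (inl-eq _ _ m) (Λ-β f ρ m)

  caseᵗ-inr : ∀ {Γ S S′ U} {f : Tm (Γ ▸ S) U} {g : Tm (Γ ▸ S′) U} {ρ m} →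
              case · ⟦ Λ f ⟧ ρ · ⟦ Λ g ⟧ ρ · (inr · m) ≡ ⟦ g ⟧ (ρ , m)
  caseᵗ-inr {f = f} {g} {ρ} {m} = trans (inr-eq _ _ m) (Λ-β g ρ m)

  caseᵗ-elim : ∀ {Γ S S′ U} (R : El U → Set) {f : Tm (Γ ▸ S) U} {g : Tm (Γ ▸ S′) U}
               {ρ v P Q} → Tagged v P Q →
               (∀ m → P m → R (⟦ f ⟧ (ρ , m))) → (∀ m → Q m → R (⟦ g ⟧ (ρ , m))) →
               R (case · ⟦ Λ f ⟧ ρ · ⟦ Λ g ⟧ ρ · v)
  caseᵗ-elim R {f} {g} (inj₁ (m , refl , p)) kl kr = subst R (sym (caseᵗ-inl {f = f} {g})) (kl m p)
  caseᵗ-elim R {f} {g} (inj₂ (m , refl , q)) kl kr = subst R (sym (caseᵗ-inr {f = f} {g})) (kr m q)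

  mapᵗ : ∀ {Γ S S′ U U′} → Tm (Γ ▸ S) U → Tm (Γ ▸ S′) U′ → Tm Γ (S +ᵗ S′) → Tm Γ (U +ᵗ U′)
  mapᵗ f g d = caseᵗ (⌜ inl ⌝ $ f) (⌜ inr ⌝ $ g) d

  mapᵗ-tagged : ∀ {Γ S S′ U U′} {f : Tm (Γ ▸ S) U} {g : Tm (Γ ▸ S′) U′} {ρ v P Q P′ Q′} →
                Tagged v P Q → (∀ m → P m → P′ (⟦ f ⟧ (ρ , m))) → (∀ m → Q m → Q′ (⟦ g ⟧ (ρ , m))) →
                Tagged (case · ⟦ Λ (⌜ inl ⌝ $ f) ⟧ ρ · ⟦ Λ (⌜ inr ⌝ $ g) ⟧ ρ · v) P′ Q′
  mapᵗ-tagged {P′ = P′} {Q′} v-tagged kl kr =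
    caseᵗ-elim (λ w → Tagged w P′ Q′) v-tagged
      (λ m p → inj₁ (_ , refl , kl m p)) (λ m q → inj₂ (_ , refl , kr m q))

module ApTypeCategory (𝒯 : TCA) where
  open TCA 𝒯
  open ApTypes 𝒯
  open ApType
  open Premor
  open Combinators 𝒯

  σ[_] : ∀ 𝒜 → El (T 𝒜 ⇒ T 𝒜 ⇒ T⁻ 𝒜 ⇒ T⁻ 𝒜)
  σ[ 𝒜 ] = proj₁ (symm 𝒜)

  τ[_] : ∀ 𝒜 → El (T 𝒜 ⇒ T 𝒜 ⇒ T 𝒜 ⇒ T⁻ 𝒜 ⇒ (T⁻ 𝒜 +ᵗ T⁻ 𝒜))
  τ[ 𝒜 ] = proj₁ (cotrans 𝒜)

  #-sym : ∀ 𝒜 {a b n} → Ap 𝒜 a b n → Ap 𝒜 b a (σ[ 𝒜 ] · a · b · n)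
  #-sym 𝒜 = proj₂ (symm 𝒜) _ _ _

  #-cotrans : ∀ 𝒜 {a₀ a₁ n} a₂ → Ap 𝒜 a₀ a₁ n → A 𝒜 a₂ →
              Tagged (τ[ 𝒜 ] · a₀ · a₁ · a₂ · n) (Ap 𝒜 a₀ a₂) (Ap 𝒜 a₁ a₂)
  #-cotrans 𝒜 a₂ = proj₂ (cotrans 𝒜) _ _ a₂ _

  Ap-≡ : ∀ 𝒜 {a a′ b b′ n n′} → a ≡ a′ → b ≡ b′ → n ≡ n′ → Ap 𝒜 a b n → Ap 𝒜 a′ b′ n′
  Ap-≡ 𝒜 refl refl refl p = p

  ∼-refl : ∀ 𝒜 a → _∼_ 𝒜 a a
  ∼-refl 𝒜 = irrefl 𝒜

  ≡⇒∼ : ∀ 𝒜 {a b} → a ≡ b → _∼_ 𝒜 a b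
  ≡⇒∼ 𝒜 refl = ∼-refl 𝒜 _

  ∼-sym : ∀ 𝒜 {a b} → _∼_ 𝒜 a b → _∼_ 𝒜 b a
  ∼-sym 𝒜 a∼b n b#a = a∼b _ (#-sym 𝒜 b#a)

  ∼-trans : ∀ 𝒜 {a b d} → A 𝒜 b → _∼_ 𝒜 a b → _∼_ 𝒜 b d → _∼_ 𝒜 a d
  ∼-trans 𝒜 b∈A a∼b b∼d n a#d with #-cotrans 𝒜 _ a#d b∈A
  ... | inj₁ (m , _ , a#b) = a∼b m a#b
  ... | inj₂ (m , _ , d#b) = b∼d _ (#-sym 𝒜 d#b)

  record IsPremor 𝒜 ℬ (F : El (T 𝒜 ⇒ T ℬ)) (G : El (T 𝒜 ⇒ T 𝒜 ⇒ T⁻ ℬ ⇒ T⁻ 𝒜)) : Set where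
    field
      preserves : ∀ a → A 𝒜 a → A ℬ (F · a)
      reflects  : ∀ a₀ a₁ n → A 𝒜 a₀ → A 𝒜 a₁ → Ap ℬ (F · a₀) (F · a₁) n →
                  Ap 𝒜 a₀ a₁ (G · a₀ · a₁ · n)
  open IsPremor

  fst-pair· : ∀ {S U V} (F : El (S ⇒ U)) (G : El V) a → fst · (pair · F · G) · a ≡ F · a
  fst-pair· F G a = cong (_· a) (fst-eq F G)

  premor : ∀ {𝒜 ℬ} F G → IsPremor 𝒜 ℬ F G → Premor 𝒜 ℬ
  premor {𝒜} {ℬ} F G isP = record
    { mor   = pair · F · G
    ; pres  = λ a a∈A → subst (A ℬ) (sym (fst-pair· F G a)) (preserves isP a a∈A)
    ; refl# = λ a₀ a₁ n a₀∈A a₁∈A Fa₀#Fa₁ →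
        subst (Ap 𝒜 a₀ a₁) (cong (λ G′ → G′ · a₀ · a₁ · n) (sym (snd-eq F G)))
          (reflects isP a₀ a₁ n a₀∈A a₁∈A (Ap-≡ ℬ (fst-pair· F G a₀) (fst-pair· F G a₁) refl Fa₀#Fa₁)) }

  infixl 9 _⟨$⟩_
  _⟨$⟩_ : ∀ {𝒜 ℬ} → Premor 𝒜 ℬ → El (T 𝒜) → El (T ℬ)
  f ⟨$⟩ a = fst · mor f · a

  ∘-⟨$⟩ : ∀ {𝒜 ℬ 𝒞} (g : Premor ℬ 𝒞) (f : Premor 𝒜 ℬ) a → (g ∘ᴾ f) ⟨$⟩ a ≡ g ⟨$⟩ (f ⟨$⟩ a)
  ∘-⟨$⟩ g f a = trans (cong (_· a) (fst-eq _ _)) (B-eq _ _ a)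

  id-⟨$⟩ : ∀ {𝒜} a → idᴾ {𝒜} ⟨$⟩ a ≡ a
  id-⟨$⟩ a = trans (cong (_· a) (fst-eq I (k · (k · I)))) (I-eq a)

  ⟨$⟩-resp-∼ : ∀ {𝒜 ℬ} (f : Premor 𝒜 ℬ) {a a′} → A 𝒜 a → A 𝒜 a′ → _∼_ 𝒜 a a′ →
               _∼_ ℬ (f ⟨$⟩ a) (f ⟨$⟩ a′)
  ⟨$⟩-resp-∼ f a∈A a′∈A a∼a′ n fa#fa′ = a∼a′ _ (refl# f _ _ n a∈A a′∈A fa#fa′)

  ≡⇒≈ᴾ : ∀ {𝒜 ℬ} (f g : Premor 𝒜 ℬ) → (∀ a → A 𝒜 a → f ⟨$⟩ a ≡ g ⟨$⟩ a) → f ≈ᴾ g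
  ≡⇒≈ᴾ {ℬ = ℬ} _ _ f≡g a a∈A = ≡⇒∼ ℬ (f≡g a a∈A)

  apIsCategory : IsCategory (ApCat 𝒯)
  apIsCategory = record
    { ≈-equiv   = λ {_} {ℬ} → record
        { refl  = λ _ _ → ∼-refl ℬ _
        ; sym   = λ f≈g a a∈A → ∼-sym ℬ (f≈g a a∈A)
        ; trans = λ {_} {g} f≈g g≈h a a∈A → ∼-trans ℬ (pres g a a∈A) (f≈g a a∈A) (g≈h a a∈A) }
    ; ∘-resp-≈  = λ {_} {_} {𝒞} {f} {f′} {g} {g′} f≈f′ g≈g′ a a∈A →
        subst₂ (_∼_ 𝒞) (sym (∘-⟨$⟩ f g a)) (sym (∘-⟨$⟩ f′ g′ a))
          (∼-trans 𝒞 (pres f′ _ (pres g a a∈A)) (f≈f′ _ (pres g a a∈A))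
            (⟨$⟩-resp-∼ f′ (pres g a a∈A) (pres g′ a a∈A) (g≈g′ a a∈A)))
    ; assoc     = λ f g h → ≡⇒≈ᴾ ((f ∘ᴾ g) ∘ᴾ h) (f ∘ᴾ (g ∘ᴾ h)) λ a _ →
        trans (∘-⟨$⟩ (f ∘ᴾ g) h a)
          (trans (∘-⟨$⟩ f g _) (sym (trans (∘-⟨$⟩ f (g ∘ᴾ h) a) (cong (f ⟨$⟩_) (∘-⟨$⟩ g h a)))))
    ; identityˡ = λ {_} {ℬ} f → ≡⇒≈ᴾ (idᴾ ∘ᴾ f) f λ a _ → trans (∘-⟨$⟩ idᴾ f a) (id-⟨$⟩ {ℬ} _)
    ; identityʳ = λ {𝒜} f → ≡⇒≈ᴾ (f ∘ᴾ idᴾ) f λ a _ → trans (∘-⟨$⟩ f idᴾ a) (cong (f ⟨$⟩_) (id-⟨$⟩ {𝒜} a))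
    }

  𝟙 : ApType
  𝟙 = record
    { T = ⊤ᵗ ; T⁻ = ⊤ᵗ ; T⁻-inh = t ; A = λ _ → Unit ; A-inh = t , tt
    ; Ap = λ _ _ _ → ⊥ ; Ap⊆A = λ () ; irrefl = λ _ _ ()
    ; symm = ⟦ Λ₃ v0 ⟧ tt , λ _ _ _ ()
    ; cotrans = ⟦ Λ₄ (⌜ inl ⌝ $ v0) ⟧ tt , λ _ _ _ _ () }

  ! : ∀ {𝒳} → Premor 𝒳 𝟙
  ! {𝒳} = premor (k · t) (⟦ Λ₃ ⌜ T⁻-inh 𝒳 ⌝ ⟧ tt) record
    { preserves = λ _ _ → tt ; reflects = λ _ _ _ _ _ () }

  terminal : Terminal (ApCat 𝒯)
  terminal = record { ⊤o = 𝟙 ; ! = ! ; !-unique = λ _ _ _ _ () }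

  point : ∀ {𝒜} a → A 𝒜 a → Premor 𝟙 𝒜
  point {𝒜} a a∈A = premor (k · a) (⟦ Λ₃ ⌜ t ⌝ ⟧ tt) record
    { preserves = λ u _ → subst (A 𝒜) (sym (k-eq a u)) a∈A
    ; reflects  = λ u₀ u₁ n _ _ a#a → ⊥-elim (irrefl 𝒜 a n (Ap-≡ 𝒜 (k-eq a u₀) (k-eq a u₁) refl a#a)) }

  ∘point-⟨$⟩ : ∀ {𝒜 ℬ} (f : Premor 𝒜 ℬ) a (a∈A : A 𝒜 a) u → (f ∘ᴾ point a a∈A) ⟨$⟩ u ≡ f ⟨$⟩ a
  ∘point-⟨$⟩ f a a∈A u =
    trans (∘-⟨$⟩ f (point a a∈A) u) (cong (f ⟨$⟩_) (trans (fst-pair· _ _ u) (k-eq a u)))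

  wellPointed : WellPointed (ApCat 𝒯) terminal
  wellPointed {_} {ℬ} f g f∘x≈g∘x a a∈A =
    subst₂ (_∼_ ℬ) (∘point-⟨$⟩ f a a∈A t) (∘point-⟨$⟩ g a a∈A t) (f∘x≈g∘x (point a a∈A) t tt)

  -- Every apartness type is inhabited, so its points make 𝟙 weakly initial.
  weakInitial : WeakInitial (ApCat 𝒯)
  weakInitial = record { ⊥o = 𝟙 ; ¡ = λ 𝒳 → point (proj₁ (A-inh 𝒳)) (proj₂ (A-inh 𝒳)) }

  module Products (𝒜 ℬ : ApType) where
    A-pair : El (T 𝒜 ×ᵗ T ℬ) → Set
    A-pair p = A 𝒜 (fst · p) × A ℬ (snd · p)

    Ap-pair : El (T 𝒜 ×ᵗ T ℬ) → El (T 𝒜 ×ᵗ T ℬ) → El (T⁻ 𝒜 +ᵗ T⁻ ℬ) → Set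
    Ap-pair p q n = A-pair p × A-pair q ×
                    Tagged n (Ap 𝒜 (fst · p) (fst · q)) (Ap ℬ (snd · p) (snd · q))

    pair-∈ : ∀ {a b} → A 𝒜 a → A ℬ b → A-pair (pair · a · b)
    pair-∈ a∈A b∈A = subst (A 𝒜) (sym (fst-eq _ _)) a∈A , subst (A ℬ) (sym (snd-eq _ _)) b∈A

    σ-pair : El ((T 𝒜 ×ᵗ T ℬ) ⇒ (T 𝒜 ×ᵗ T ℬ) ⇒ (T⁻ 𝒜 +ᵗ T⁻ ℬ) ⇒ (T⁻ 𝒜 +ᵗ T⁻ ℬ))
    σ-pair = ⟦ Λ₃ (mapᵗ (⌜ σ[ 𝒜 ] ⌝ $ (⌜ fst ⌝ $ v3) $ (⌜ fst ⌝ $ v2) $ v0)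
                        (⌜ σ[ ℬ ] ⌝ $ (⌜ snd ⌝ $ v3) $ (⌜ snd ⌝ $ v2) $ v0) v0) ⟧ tt

    σ-pair-sym : ∀ p q n → Ap-pair p q n → Ap-pair q p (σ-pair · p · q · n)
    σ-pair-sym p q n (p∈A , q∈A , n-tagged) =
      q∈A , p∈A , Tagged-≡ (Λ₃-β _ tt p q n)
        (mapᵗ-tagged n-tagged (λ _ → #-sym 𝒜) (λ _ → #-sym ℬ))

    τ-pair : El ((T 𝒜 ×ᵗ T ℬ) ⇒ (T 𝒜 ×ᵗ T ℬ) ⇒ (T 𝒜 ×ᵗ T ℬ) ⇒ (T⁻ 𝒜 +ᵗ T⁻ ℬ) ⇒
                 ((T⁻ 𝒜 +ᵗ T⁻ ℬ) +ᵗ (T⁻ 𝒜 +ᵗ T⁻ ℬ)))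
    τ-pair = ⟦ Λ₄ (caseᵗ
      (mapᵗ (⌜ inl ⌝ $ v0) (⌜ inl ⌝ $ v0) (⌜ τ[ 𝒜 ] ⌝ $ (⌜ fst ⌝ $ v4) $ (⌜ fst ⌝ $ v3) $ (⌜ fst ⌝ $ v2) $ v0))
      (mapᵗ (⌜ inr ⌝ $ v0) (⌜ inr ⌝ $ v0) (⌜ τ[ ℬ ] ⌝ $ (⌜ snd ⌝ $ v4) $ (⌜ snd ⌝ $ v3) $ (⌜ snd ⌝ $ v2) $ v0))
      v0) ⟧ tt

    τ-pair-cotrans : ∀ p q r n → Ap-pair p q n → A-pair r →
                     Tagged (τ-pair · p · q · r · n) (Ap-pair p r) (Ap-pair q r)
    τ-pair-cotrans p q r n (p∈A , q∈A , n-tagged) r∈A@(fst-r∈A , snd-r∈A) =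
      Tagged-≡ (Λ₄-β _ tt p q r n)
        (caseᵗ-elim (λ w → Tagged w (Ap-pair p r) (Ap-pair q r)) n-tagged
          (λ _ fst# → mapᵗ-tagged (#-cotrans 𝒜 _ fst# fst-r∈A)
            (λ _ p#r → p∈A , r∈A , inj₁ (_ , refl , p#r)) (λ _ q#r → q∈A , r∈A , inj₁ (_ , refl , q#r)))
          (λ _ snd# → mapᵗ-tagged (#-cotrans ℬ _ snd# snd-r∈A)
            (λ _ p#r → p∈A , r∈A , inj₂ (_ , refl , p#r)) (λ _ q#r → q∈A , r∈A , inj₂ (_ , refl , q#r))))

    𝒜×ℬ : ApType
    𝒜×ℬ = record
      { T = T 𝒜 ×ᵗ T ℬ ; T⁻ = T⁻ 𝒜 +ᵗ T⁻ ℬ ; T⁻-inh = inl · T⁻-inh 𝒜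
      ; A = A-pair
      ; A-inh = pair · proj₁ (A-inh 𝒜) · proj₁ (A-inh ℬ) , pair-∈ (proj₂ (A-inh 𝒜)) (proj₂ (A-inh ℬ))
      ; Ap = Ap-pair ; Ap⊆A = λ (p∈A , q∈A , _) → p∈A , q∈A
      ; irrefl = λ { _ _ (_ , _ , inj₁ (m , _ , a#a)) → irrefl 𝒜 _ m a#a
                   ; _ _ (_ , _ , inj₂ (m , _ , b#b)) → irrefl ℬ _ m b#b }
      ; symm = σ-pair , σ-pair-sym
      ; cotrans = τ-pair , τ-pair-cotrans }

    pair-η : ∀ p → _∼_ 𝒜×ℬ (pair · (fst · p) · (snd · p)) p
    pair-η p n (_ , _ , inj₁ (m , _ , fst#)) = irrefl 𝒜 _ m (Ap-≡ 𝒜 (fst-eq _ _) refl refl fst#)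
    pair-η p n (_ , _ , inj₂ (m , _ , snd#)) = irrefl ℬ _ m (Ap-≡ ℬ (snd-eq _ _) refl refl snd#)

    π₁ᴾ : Premor 𝒜×ℬ 𝒜
    π₁ᴾ = premor fst (⟦ Λ₃ (⌜ inl ⌝ $ v0) ⟧ tt) record
      { preserves = λ _ → proj₁
      ; reflects  = λ p q n p∈A q∈A fst# → p∈A , q∈A , inj₁ (n , Λ₃-β _ tt p q n , fst#) }

    π₂ᴾ : Premor 𝒜×ℬ ℬ
    π₂ᴾ = premor snd (⟦ Λ₃ (⌜ inr ⌝ $ v0) ⟧ tt) record
      { preserves = λ _ → proj₂
      ; reflects  = λ p q n p∈A q∈A snd# → p∈A , q∈A , inj₂ (n , Λ₃-β _ tt p q n , snd#) }

    module _ {𝒳 : ApType} (f : Premor 𝒳 𝒜) (g : Premor 𝒳 ℬ) where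
      pairing : El (T 𝒳 ⇒ T 𝒜 ×ᵗ T ℬ)
      pairing = ⟦ Λ (⌜ pair ⌝ $ (⌜ fst · mor f ⌝ $ v0) $ (⌜ fst · mor g ⌝ $ v0)) ⟧ tt

      fst-pairing : ∀ x → fst · (pairing · x) ≡ f ⟨$⟩ x
      fst-pairing x = trans (cong (fst ·_) (Λ-β _ tt x)) (fst-eq _ _)

      snd-pairing : ∀ x → snd · (pairing · x) ≡ g ⟨$⟩ x
      snd-pairing x = trans (cong (snd ·_) (Λ-β _ tt x)) (snd-eq _ _)

      ⟨_,_⟩ᴾ : Premor 𝒳 𝒜×ℬ
      ⟨_,_⟩ᴾ = premor pairing
        (⟦ Λ₃ (caseᵗ (⌜ snd · mor f ⌝ $ v3 $ v2 $ v0) (⌜ snd · mor g ⌝ $ v3 $ v2 $ v0) v0) ⟧ tt)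
        record
        { preserves = λ x x∈A → subst (A 𝒜) (sym (fst-pairing x)) (pres f x x∈A)
                              , subst (A ℬ) (sym (snd-pairing x)) (pres g x x∈A)
        ; reflects  = λ x y n x∈A y∈A (_ , _ , n-tagged) →
            subst (Ap 𝒳 x y) (sym (Λ₃-β _ tt x y n))
              (caseᵗ-elim (Ap 𝒳 x y) n-tagged
                (λ m fst# → refl# f x y m x∈A y∈A (Ap-≡ 𝒜 (fst-pairing x) (fst-pairing y) refl fst#))
                (λ m snd# → refl# g x y m x∈A y∈A (Ap-≡ ℬ (snd-pairing x) (snd-pairing y) refl snd#))) }

      ⟨,⟩-fst : ∀ x → fst · (⟨_,_⟩ᴾ ⟨$⟩ x) ≡ f ⟨$⟩ x
      ⟨,⟩-fst x = trans (cong (fst ·_) (fst-pair· _ _ x)) (fst-pairing x)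

      ⟨,⟩-snd : ∀ x → snd · (⟨_,_⟩ᴾ ⟨$⟩ x) ≡ g ⟨$⟩ x
      ⟨,⟩-snd x = trans (cong (snd ·_) (fst-pair· _ _ x)) (snd-pairing x)

    π₁-⟨$⟩ : ∀ {𝒳} (h : Premor 𝒳 𝒜×ℬ) x → (π₁ᴾ ∘ᴾ h) ⟨$⟩ x ≡ fst · (h ⟨$⟩ x)
    π₁-⟨$⟩ h x = trans (∘-⟨$⟩ π₁ᴾ h x) (fst-pair· _ _ _)

    π₂-⟨$⟩ : ∀ {𝒳} (h : Premor 𝒳 𝒜×ℬ) x → (π₂ᴾ ∘ᴾ h) ⟨$⟩ x ≡ snd · (h ⟨$⟩ x)
    π₂-⟨$⟩ h x = trans (∘-⟨$⟩ π₂ᴾ h x) (fst-pair· _ _ _)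

    product : Product (ApCat 𝒯) 𝒜 ℬ
    product = record
      { A×B = 𝒜×ℬ ; π₁ = π₁ᴾ ; π₂ = π₂ᴾ ; ⟨_,_⟩ = ⟨_,_⟩ᴾ
      ; π₁-β = λ f g → ≡⇒≈ᴾ (π₁ᴾ ∘ᴾ ⟨ f , g ⟩ᴾ) f λ x _ → trans (π₁-⟨$⟩ ⟨ f , g ⟩ᴾ x) (⟨,⟩-fst f g x)
      ; π₂-β = λ f g → ≡⇒≈ᴾ (π₂ᴾ ∘ᴾ ⟨ f , g ⟩ᴾ) g λ x _ → trans (π₂-⟨$⟩ ⟨ f , g ⟩ᴾ x) (⟨,⟩-snd f g x)
      ; unique = unique }
      where
      unique : ∀ {𝒳} (f : Premor 𝒳 𝒜) (g : Premor 𝒳 ℬ) (h : Premor 𝒳 𝒜×ℬ) →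
               (π₁ᴾ ∘ᴾ h) ≈ᴾ f → (π₂ᴾ ∘ᴾ h) ≈ᴾ g → h ≈ᴾ ⟨ f , g ⟩ᴾ
      unique f g h π₁h≈f _ x x∈A n (_ , _ , inj₁ (m , _ , fst#)) =
        π₁h≈f x x∈A m (Ap-≡ 𝒜 (sym (π₁-⟨$⟩ h x)) (⟨,⟩-fst f g x) refl fst#)
      unique f g h _ π₂h≈g x x∈A n (_ , _ , inj₂ (m , _ , snd#)) =
        π₂h≈g x x∈A m (Ap-≡ ℬ (sym (π₂-⟨$⟩ h x)) (⟨,⟩-snd f g x) refl snd#)

  products : BinaryProducts (ApCat 𝒯)
  products 𝒜 ℬ = Products.product 𝒜 ℬ

  module Exponentials (𝒜 ℬ : ApType) where
    TE : Ty
    TE = (T 𝒜 ⇒ T ℬ) ×ᵗ (T 𝒜 ⇒ T 𝒜 ⇒ T⁻ ℬ ⇒ T⁻ 𝒜)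

    TE⁻ : Ty
    TE⁻ = T 𝒜 ×ᵗ T⁻ ℬ

    app : ∀ {Γ} → Tm Γ TE → Tm Γ (T 𝒜) → Tm Γ (T ℬ)
    app f a = ⌜ fst ⌝ $ f $ a

    IsPremorᴱ : El TE → Set
    IsPremorᴱ f = IsPremor 𝒜 ℬ (fst · f) (snd · f)

    -- The witness is a point paired with an apartness of the values there.
    Ap-fun : El TE → El TE → El TE⁻ → Set
    Ap-fun f g n = IsPremorᴱ f × IsPremorᴱ g × A 𝒜 (fst · n)
                 × Ap ℬ (fst · f · (fst · n)) (fst · g · (fst · n)) (snd · n)

    Ap-fun-at : ∀ {f g a m} → IsPremorᴱ f → IsPremorᴱ g → A 𝒜 a →
                Ap ℬ (fst · f · a) (fst · g · a) m → Ap-fun f g (pair · a · m)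
    Ap-fun-at isPf isPg a∈A fa#ga =
      isPf , isPg , subst (A 𝒜) (sym (fst-eq _ _)) a∈A
      , Ap-≡ ℬ (cong (fst · _ ·_) (sym (fst-eq _ _))) (cong (fst · _ ·_) (sym (fst-eq _ _)))
          (sym (snd-eq _ _)) fa#ga

    σ-fun : El (TE ⇒ TE ⇒ TE⁻ ⇒ TE⁻)
    σ-fun = ⟦ Λ₃ (⌜ pair ⌝ $ (⌜ fst ⌝ $ v0)
                  $ (⌜ σ[ ℬ ] ⌝ $ app v2 (⌜ fst ⌝ $ v0) $ app v1 (⌜ fst ⌝ $ v0) $ (⌜ snd ⌝ $ v0))) ⟧ tt

    σ-fun-sym : ∀ f g n → Ap-fun f g n → Ap-fun g f (σ-fun · f · g · n)
    σ-fun-sym f g n (isPf , isPg , a∈A , fa#ga) =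
      subst (Ap-fun g f) (sym (Λ₃-β _ tt f g n)) (Ap-fun-at isPg isPf a∈A (#-sym ℬ fa#ga))

    τ-fun : El (TE ⇒ TE ⇒ TE ⇒ TE⁻ ⇒ (TE⁻ +ᵗ TE⁻))
    τ-fun = ⟦ Λ₄ (mapᵗ (⌜ pair ⌝ $ (⌜ fst ⌝ $ v1) $ v0) (⌜ pair ⌝ $ (⌜ fst ⌝ $ v1) $ v0)
                   (⌜ τ[ ℬ ] ⌝ $ app v3 (⌜ fst ⌝ $ v0) $ app v2 (⌜ fst ⌝ $ v0) $ app v1 (⌜ fst ⌝ $ v0)
                               $ (⌜ snd ⌝ $ v0))) ⟧ tt

    τ-fun-cotrans : ∀ f g h n → Ap-fun f g n → IsPremorᴱ h →
                    Tagged (τ-fun · f · g · h · n) (Ap-fun f h) (Ap-fun g h)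
    τ-fun-cotrans f g h n (isPf , isPg , a∈A , fa#ga) isPh =
      Tagged-≡ (Λ₄-β _ tt f g h n)
        (mapᵗ-tagged (#-cotrans ℬ _ fa#ga (preserves isPh _ a∈A))
          (λ _ → Ap-fun-at isPf isPh a∈A) (λ _ → Ap-fun-at isPg isPh a∈A))

    constᴱ : El TE
    constᴱ = pair · (k · proj₁ (A-inh ℬ)) · ⟦ Λ₃ ⌜ T⁻-inh 𝒜 ⌝ ⟧ tt

    constᴱ-isPremor : IsPremorᴱ constᴱ
    constᴱ-isPremor = record
      { preserves = λ a _ → subst (A ℬ) (sym (const-at a)) (proj₂ (A-inh ℬ))
      ; reflects  = λ a₀ a₁ n _ _ b#b →
          ⊥-elim (irrefl ℬ _ n (Ap-≡ ℬ (const-at a₀) (const-at a₁) refl b#b)) }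
      where
      const-at : ∀ a → fst · constᴱ · a ≡ proj₁ (A-inh ℬ)
      const-at a = trans (fst-pair· _ _ a) (k-eq _ a)

    ℬ^𝒜 : ApType
    ℬ^𝒜 = record
      { T = TE ; T⁻ = TE⁻ ; T⁻-inh = pair · proj₁ (A-inh 𝒜) · T⁻-inh ℬ
      ; A = IsPremorᴱ ; A-inh = constᴱ , constᴱ-isPremor
      ; Ap = Ap-fun ; Ap⊆A = λ (isPf , isPg , _) → isPf , isPg
      ; irrefl = λ _ _ (_ , _ , _ , fa#fa) → irrefl ℬ _ _ fa#fa
      ; symm = σ-fun , σ-fun-sym
      ; cotrans = τ-fun , τ-fun-cotrans }

    module ℬ^𝒜×𝒜 = Products ℬ^𝒜 𝒜

    evalᴾ : Premor ℬ^𝒜×𝒜.𝒜×ℬ ℬ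
    evalᴾ = premor (⟦ Λ (app (⌜ fst ⌝ $ v0) (⌜ snd ⌝ $ v0)) ⟧ tt)
      (⟦ Λ₃ (mapᵗ (⌜ pair ⌝ $ (⌜ snd ⌝ $ v3) $ v0)
                  (⌜ snd ⌝ $ (⌜ fst ⌝ $ v2) $ (⌜ snd ⌝ $ v3) $ (⌜ snd ⌝ $ v2)
                    $ (⌜ σ[ ℬ ] ⌝ $ app (⌜ fst ⌝ $ v2) (⌜ snd ⌝ $ v2) $ app (⌜ fst ⌝ $ v2) (⌜ snd ⌝ $ v3) $ v0))
                  (⌜ τ[ ℬ ] ⌝ $ app (⌜ fst ⌝ $ v2) (⌜ snd ⌝ $ v2) $ app (⌜ fst ⌝ $ v1) (⌜ snd ⌝ $ v1)
                              $ app (⌜ fst ⌝ $ v1) (⌜ snd ⌝ $ v2) $ v0)) ⟧ tt)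
      record
      { preserves = λ p (isPf , a∈A) → subst (A ℬ) (sym (Λ-β _ tt p)) (preserves isPf _ a∈A)
      ; reflects  = λ p q m p∈A@(isPf , a∈A) q∈A@(isPg , b∈A) fa#gb →
          p∈A , q∈A
          , Tagged-≡ (Λ₃-β _ tt p q m)
              (mapᵗ-tagged
                (#-cotrans ℬ _ (Ap-≡ ℬ (Λ-β _ tt p) (Λ-β _ tt q) refl fa#gb) (preserves isPg _ a∈A))
                (λ _ → Ap-fun-at isPf isPg a∈A)
                (λ _ gb#ga → reflects isPg _ _ _ a∈A b∈A (#-sym ℬ gb#ga))) }

    eval-⟨$⟩ : ∀ p → evalᴾ ⟨$⟩ p ≡ fst · (fst · p) · (snd · p)
    eval-⟨$⟩ p = trans (fst-pair· _ _ p) (Λ-β _ tt p)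

    module Curry {𝒳 : ApType} (h : Premor (Products.𝒜×ℬ 𝒳 𝒜) ℬ) where
      open Products 𝒳 𝒜 using (pair-∈)

      -- In both reflection maps below, one alternative of h's witness would make an element
      -- apart from itself, so its branch returns an arbitrary witness.
      curried : El (T 𝒳 ⇒ TE)
      curried = ⟦ Λ (⌜ pair ⌝ $ Λ (⌜ fst · mor h ⌝ $ (⌜ pair ⌝ $ v1 $ v0))
                             $ Λ₃ (caseᵗ ⌜ T⁻-inh 𝒜 ⌝ v0
                                     (⌜ snd · mor h ⌝ $ (⌜ pair ⌝ $ v3 $ v2) $ (⌜ pair ⌝ $ v3 $ v1) $ v0))) ⟧ tt

      curried-fst : ∀ x a → fst · (curried · x) · a ≡ h ⟨$⟩ (pair · x · a)
      curried-fst x a =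
        trans (cong (λ c → fst · c · a) (Λ-β _ tt x)) (trans (fst-pair· _ _ a) (Λ-β _ (tt , x) a))

      curried-snd : ∀ x a₀ a₁ m → snd · (curried · x) · a₀ · a₁ · m ≡
                    case · ⟦ Λ ⌜ T⁻-inh 𝒜 ⌝ ⟧ ((((tt , x) , a₀) , a₁) , m) · ⟦ Λ v0 ⟧ ((((tt , x) , a₀) , a₁) , m)
                         · (snd · mor h · (pair · x · a₀) · (pair · x · a₁) · m)
      curried-snd x a₀ a₁ m =
        trans (cong (λ c → snd · c · a₀ · a₁ · m) (Λ-β _ tt x))
          (trans (cong (λ c → c · a₀ · a₁ · m) (snd-eq _ _)) (Λ₃-β _ (tt , x) a₀ a₁ m))

      curried-isPremor : ∀ x → A 𝒳 x → IsPremorᴱ (curried · x)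
      curried-isPremor x x∈A = record
        { preserves = λ a a∈A → subst (A ℬ) (sym (curried-fst x a)) (pres h _ (pair-∈ x∈A a∈A))
        ; reflects  = λ a₀ a₁ m a₀∈A a₁∈A ha₀#ha₁ →
            subst (Ap 𝒜 a₀ a₁) (sym (curried-snd x a₀ a₁ m))
              (caseᵗ-elim (Ap 𝒜 a₀ a₁)
                (proj₂ (proj₂ (refl# h _ _ m (pair-∈ x∈A a₀∈A) (pair-∈ x∈A a₁∈A)
                  (Ap-≡ ℬ (curried-fst x a₀) (curried-fst x a₁) refl ha₀#ha₁))))
                (λ _ x#x → ⊥-elim (irrefl 𝒳 x _ (Ap-≡ 𝒳 (fst-eq _ _) (fst-eq _ _) refl x#x)))
                (λ _ a₀#a₁ → Ap-≡ 𝒜 (snd-eq _ _) (snd-eq _ _) refl a₀#a₁)) }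

      curryᴾ : Premor 𝒳 ℬ^𝒜
      curryᴾ = premor curried
        (⟦ Λ₃ (caseᵗ v0 ⌜ T⁻-inh 𝒳 ⌝
                 (⌜ snd · mor h ⌝ $ (⌜ pair ⌝ $ v2 $ (⌜ fst ⌝ $ v0)) $ (⌜ pair ⌝ $ v1 $ (⌜ fst ⌝ $ v0))
                                  $ (⌜ snd ⌝ $ v0))) ⟧ tt)
        record
        { preserves = curried-isPremor
        ; reflects  = λ x y n x∈A y∈A (_ , _ , a∈A , hxa#hya) →
            subst (Ap 𝒳 x y) (sym (Λ₃-β _ tt x y n))
              (caseᵗ-elim (Ap 𝒳 x y)
                (proj₂ (proj₂ (refl# h _ _ _ (pair-∈ x∈A a∈A) (pair-∈ y∈A a∈A)
                  (Ap-≡ ℬ (curried-fst x _) (curried-fst y _) refl hxa#hya))))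
                (λ _ x#y → Ap-≡ 𝒳 (fst-eq _ _) (fst-eq _ _) refl x#y)
                (λ _ a#a → ⊥-elim (irrefl 𝒜 _ _ (Ap-≡ 𝒜 (snd-eq _ _) (snd-eq _ _) refl a#a)))) }

      curry-⟨$⟩ : ∀ x a → fst · (curryᴾ ⟨$⟩ x) · a ≡ h ⟨$⟩ (pair · x · a)
      curry-⟨$⟩ x a = trans (cong (λ c → fst · c · a) (fst-pair· _ _ x)) (curried-fst x a)

    eval∘×id-⟨$⟩ : ∀ {𝒳} (g : Premor 𝒳 ℬ^𝒜) p →
                   (evalᴾ ∘ᴾ (_×id[_] (ApCat 𝒯) g products {𝒜})) ⟨$⟩ p ≡ fst · (g ⟨$⟩ (fst · p)) · (snd · p)
    eval∘×id-⟨$⟩ {𝒳} g p =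
      trans (∘-⟨$⟩ evalᴾ g×id p)
        (trans (eval-⟨$⟩ _)
          (cong₂ (λ u v → fst · u · v)
            (trans (ℬ^𝒜×𝒜.⟨,⟩-fst (g ∘ᴾ π₁ᴾ) π₂ᴾ p) (trans (∘-⟨$⟩ g π₁ᴾ p) (cong (g ⟨$⟩_) (fst-pair· _ _ p))))
            (trans (ℬ^𝒜×𝒜.⟨,⟩-snd (g ∘ᴾ π₁ᴾ) π₂ᴾ p) (fst-pair· _ _ p))))
      where
      open Products 𝒳 𝒜 using (π₁ᴾ; π₂ᴾ)
      g×id = _×id[_] (ApCat 𝒯) g products {𝒜}

    exponential : Exponential (ApCat 𝒯) products 𝒜 ℬ
    exponential = record
      { B^A = ℬ^𝒜 ; eval = evalᴾ ; curry = Curry.curryᴾ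
      ; β = λ {𝒳} h p p∈A@(x∈A , a∈A) →
          subst₂ (_∼_ ℬ) (sym (trans (eval∘×id-⟨$⟩ (Curry.curryᴾ {𝒳} h) p) (Curry.curry-⟨$⟩ {𝒳} h _ _))) refl
            (⟨$⟩-resp-∼ h (Products.pair-∈ 𝒳 𝒜 x∈A a∈A) p∈A (Products.pair-η 𝒳 𝒜 p))
      ; unique = λ {𝒳} h g eval∘g×id≈h x x∈A n (_ , _ , a∈A , gxa#curryxa) →
          eval∘g×id≈h _ (Products.pair-∈ 𝒳 𝒜 x∈A a∈A) _
            (Ap-≡ ℬ (sym (trans (eval∘×id-⟨$⟩ g _)
                           (cong₂ (λ u v → fst · (g ⟨$⟩ u) · v) (fst-eq _ _) (snd-eq _ _))))
                    (Curry.curry-⟨$⟩ {𝒳} h x _) refl gxa#curryxa) }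

  cartesianClosed : CartesianClosed (ApCat 𝒯)
  cartesianClosed = record
    { terminal = terminal ; products = products ; exponentials = Exponentials.exponential }

  module Naturals (consistent : Consistent 𝒯) where
    numeral : ℕ → El Nᵗ
    numeral zero    = 0ᶜ
    numeral (suc j) = succ · numeral j

    IsNumeral : El Nᵗ → Set
    IsNumeral n = Σ ℕ λ j → numeral j ≡ n

    -- Primitive recursion on m at type Nᵗ ⇒ (⊤ᵗ +ᵗ ⊤ᵗ), and inside it on n.
    apart? : El (Nᵗ ⇒ Nᵗ ⇒ (⊤ᵗ +ᵗ ⊤ᵗ))
    apart? = R · (R · (inr · t) · ⟦ Λ₂ ⌜ inl · t ⌝ ⟧ tt) · ⟦ Λ₂ (⌜ R ⌝ $ ⌜ inl · t ⌝ $ Λ₂ (v2 $ v1)) ⟧ tt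

    apart?-0 : ∀ n → apart? · 0ᶜ · n ≡ R · (inr · t) · ⟦ Λ₂ ⌜ inl · t ⌝ ⟧ tt · n
    apart?-0 n = cong (_· n) (R0-eq _ _)

    apart?-suc : ∀ m n → apart? · (succ · m) · n ≡ R · (inl · t) · ⟦ Λ₂ (v2 $ v1) ⟧ ((tt , m) , apart? · m) · n
    apart?-suc m n = cong (_· n) (trans (RS-eq _ _ m) (Λ₂-β _ tt m _))

    apart?-numeral : ∀ j l → Tagged (apart? · numeral j · numeral l) (λ _ → ¬ j ≡ l) (λ _ → j ≡ l)
    apart?-numeral zero zero = inj₂ (t , trans (apart?-0 _) (R0-eq _ _) , refl)
    apart?-numeral zero (suc l) =
      inj₁ (t , trans (apart?-0 _) (trans (RS-eq _ _ _) (Λ₂-β _ tt _ _)) , λ ())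
    apart?-numeral (suc j) zero = inj₁ (t , trans (apart?-suc _ _) (R0-eq _ _) , λ ())
    apart?-numeral (suc j) (suc l) =
      Tagged-≡ (trans (apart?-suc _ _) (trans (RS-eq _ _ _) (Λ₂-β _ _ _ _)))
        (Tagged-map (λ j≢l → j≢l ∘ suc-injective) (cong suc) (apart?-numeral j l))

    numeral-injective : ∀ {j l} → numeral j ≡ numeral l → j ≡ l
    numeral-injective {j} {l} e with apart?-numeral j l | apart?-numeral j j
    ... | inj₂ (_ , _ , j≡l) | _                        = j≡l
    ... | inj₁ _             | inj₁ (_ , _ , j≢j)       = ⊥-elim (j≢j refl)
    ... | inj₁ (_ , jl , _)  | inj₂ (_ , jj , _)        =
      ⊥-elim (inl≢inr consistent (trans (sym jl) (trans (cong (apart? · numeral j ·_) (sym e)) jj)))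

    Ap-ℕ : El Nᵗ → El Nᵗ → El ⊤ᵗ → Set
    Ap-ℕ m n _ = IsNumeral m × IsNumeral n × ¬ m ≡ n

    -- Comparing a₀ with a₂ decides which disjunct of cotransitivity holds.
    τ-ℕ-cotrans : ∀ a₀ a₁ a₂ u → Ap-ℕ a₀ a₁ u → IsNumeral a₂ →
                  Tagged (apart? · a₀ · a₂) (Ap-ℕ a₀ a₂) (Ap-ℕ a₁ a₂)
    τ-ℕ-cotrans _ a₁ _ _ ((j , refl) , a₁∈A , a₀≢a₁) (l , refl) =
      Tagged-map (λ j≢l → (j , refl) , (l , refl) , j≢l ∘ numeral-injective)
                 (λ { refl → a₁∈A , (j , refl) , a₀≢a₁ ∘ sym })
                 (apart?-numeral j l)

    𝒩 : ApType
    𝒩 = record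
      { T = Nᵗ ; T⁻ = ⊤ᵗ ; T⁻-inh = t ; A = IsNumeral ; A-inh = 0ᶜ , (0 , refl)
      ; Ap = Ap-ℕ ; Ap⊆A = λ (m∈A , n∈A , _) → m∈A , n∈A
      ; irrefl = λ _ _ (_ , _ , n≢n) → n≢n refl
      ; symm = ⟦ Λ₃ v0 ⟧ tt , λ _ _ _ (m∈A , n∈A , m≢n) → n∈A , m∈A , m≢n ∘ sym
      ; cotrans = ⟦ Λ₄ (⌜ apart? ⌝ $ v3 $ v1) ⟧ tt , λ a₀ a₁ a₂ u a₀#a₁ a₂∈A →
          Tagged-≡ (Λ₄-β _ tt a₀ a₁ a₂ u) (τ-ℕ-cotrans a₀ a₁ a₂ u a₀#a₁ a₂∈A) }

    zeroᴾ : Premor 𝟙 𝒩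
    zeroᴾ = premor (k · 0ᶜ) (⟦ Λ₃ ⌜ t ⌝ ⟧ tt) record
      { preserves = λ u _ → 0 , sym (k-eq _ u)
      ; reflects  = λ u₀ u₁ _ _ _ (_ , _ , 0≢0) → ⊥-elim (0≢0 (trans (k-eq _ u₀) (sym (k-eq _ u₁)))) }

    succᴾ : Premor 𝒩 𝒩
    succᴾ = premor succ (⟦ Λ₃ v0 ⟧ tt) record
      { preserves = λ _ (j , e) → suc j , cong (succ ·_) e
      ; reflects  = λ _ _ _ m∈A n∈A (_ , _ , sm≢sn) → m∈A , n∈A , sm≢sn ∘ cong (succ ·_) }

    module _ {𝒳 : ApType} (x : Premor 𝟙 𝒳) (f : Premor 𝒳 𝒳) where
      iterated : El (Nᵗ ⇒ T 𝒳)
      iterated = R · (x ⟨$⟩ t) · ⟦ Λ₂ (⌜ fst · mor f ⌝ $ v0) ⟧ tt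

      iterated-0 : iterated · 0ᶜ ≡ x ⟨$⟩ t
      iterated-0 = R0-eq _ _

      iterated-suc : ∀ n → iterated · (succ · n) ≡ f ⟨$⟩ (iterated · n)
      iterated-suc n = trans (RS-eq _ _ n) (Λ₂-β _ tt n _)

      iterated-∈ : ∀ j → A 𝒳 (iterated · numeral j)
      iterated-∈ zero    = subst (A 𝒳) (sym iterated-0) (pres x t tt)
      iterated-∈ (suc j) = subst (A 𝒳) (sym (iterated-suc _)) (pres f _ (iterated-∈ j))

      iterateᴾ : Premor 𝒩 𝒳
      iterateᴾ = premor iterated (⟦ Λ₃ ⌜ t ⌝ ⟧ tt) record
        { preserves = λ { _ (j , refl) → iterated-∈ j }
        ; reflects  = λ m n u m∈A n∈A fm#fn →
            m∈A , n∈A , λ { refl → irrefl 𝒳 _ _ fm#fn } }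

      iterate-⟨$⟩ : ∀ n → iterateᴾ ⟨$⟩ n ≡ iterated · n
      iterate-⟨$⟩ = fst-pair· _ _

    ∘zero-⟨$⟩ : ∀ {𝒳} (g : Premor 𝒩 𝒳) u → (g ∘ᴾ zeroᴾ) ⟨$⟩ u ≡ g ⟨$⟩ 0ᶜ
    ∘zero-⟨$⟩ g u = trans (∘-⟨$⟩ g zeroᴾ u) (cong (g ⟨$⟩_) (trans (fst-pair· _ _ u) (k-eq _ u)))

    ∘succ-⟨$⟩ : ∀ {𝒳} (g : Premor 𝒩 𝒳) n → (g ∘ᴾ succᴾ) ⟨$⟩ n ≡ g ⟨$⟩ (succ · n)
    ∘succ-⟨$⟩ g n = trans (∘-⟨$⟩ g succᴾ n) (cong (g ⟨$⟩_) (fst-pair· _ _ n))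

    nno : NNO (ApCat 𝒯) terminal
    nno = record
      { N = 𝒩 ; z = zeroᴾ ; sc = succᴾ ; iter = iterateᴾ
      ; iter-z = λ {𝒳} x f u _ →
          subst₂ (_∼_ 𝒳) (sym (trans (∘zero-⟨$⟩ (iterateᴾ x f) u) (trans (iterate-⟨$⟩ x f _) (iterated-0 x f))))
            refl
            -- u need not be t, but no two elements of 𝟙 are apart.
            (⟨$⟩-resp-∼ x tt tt λ _ ())
      ; iter-s = λ x f → ≡⇒≈ᴾ (iterateᴾ x f ∘ᴾ succᴾ) (f ∘ᴾ iterateᴾ x f) λ n _ → begin
          (iterateᴾ x f ∘ᴾ succᴾ) ⟨$⟩ n  ≡⟨ ∘succ-⟨$⟩ (iterateᴾ x f) n ⟩
          iterateᴾ x f ⟨$⟩ (succ · n)    ≡⟨ iterate-⟨$⟩ x f _ ⟩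
          iterated x f · (succ · n)      ≡⟨ iterated-suc x f n ⟩
          f ⟨$⟩ (iterated x f · n)       ≡⟨ cong (f ⟨$⟩_) (sym (iterate-⟨$⟩ x f n)) ⟩
          f ⟨$⟩ (iterateᴾ x f ⟨$⟩ n)     ≡⟨ sym (∘-⟨$⟩ f (iterateᴾ x f) n) ⟩
          (f ∘ᴾ iterateᴾ x f) ⟨$⟩ n      ∎
      ; unique = unique }
      where
      open ≡-Reasoning
      unique : ∀ {𝒳} (x : Premor 𝟙 𝒳) (f : Premor 𝒳 𝒳) (u : Premor 𝒩 𝒳) →
               (u ∘ᴾ zeroᴾ) ≈ᴾ x → (u ∘ᴾ succᴾ) ≈ᴾ (f ∘ᴾ u) → u ≈ᴾ iterateᴾ x f
      unique {𝒳} x f u u0≈x us≈fu _ (j , refl) =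
        subst (_∼_ 𝒳 (u ⟨$⟩ numeral j)) (sym (iterate-⟨$⟩ x f _)) (agree j)
        where
        agree : ∀ j → _∼_ 𝒳 (u ⟨$⟩ numeral j) (iterated x f · numeral j)
        agree zero = subst₂ (_∼_ 𝒳) (∘zero-⟨$⟩ u t) (sym (iterated-0 x f)) (u0≈x t tt)
        agree (suc j) = ∼-trans 𝒳 (pres f _ (pres u _ (j , refl)))
          (subst₂ (_∼_ 𝒳) (∘succ-⟨$⟩ u _) (∘-⟨$⟩ f u _) (us≈fu _ (j , refl)))
          (subst (_∼_ 𝒳 _) (sym (iterated-suc x f _))
            (⟨$⟩-resp-∼ f (pres u _ (j , refl)) (iterated-∈ x f j) (agree j)))

  module Coproducts (consistent : Consistent 𝒯) (𝒜 ℬ : ApType) where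
    TC : Ty
    TC = T 𝒜 +ᵗ T ℬ

    TC⁻ : Ty
    TC⁻ = T⁻ 𝒜 ×ᵗ T⁻ ℬ

    A-sum : El TC → Set
    A-sum x = Tagged x (A 𝒜) (A ℬ)

    -- Across summands the witness carries no information.
    data Ap-sum : El TC → El TC → El TC⁻ → Set where
      inl#inl : ∀ {a a′ n} → Ap 𝒜 a a′ (fst · n) → Ap-sum (inl · a) (inl · a′) n
      inr#inr : ∀ {b b′ n} → Ap ℬ b b′ (snd · n) → Ap-sum (inr · b) (inr · b′) n
      inl#inr : ∀ {a b n} → A 𝒜 a → A ℬ b → Ap-sum (inl · a) (inr · b) n
      inr#inl : ∀ {b a n} → A ℬ b → A 𝒜 a → Ap-sum (inr · b) (inl · a) n

    Ap-sum⊆A : ∀ {x y n} → Ap-sum x y n → A-sum x × A-sum y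
    Ap-sum⊆A (inl#inl a#a′) = inj₁ (_ , refl , proj₁ (Ap⊆A 𝒜 a#a′)) , inj₁ (_ , refl , proj₂ (Ap⊆A 𝒜 a#a′))
    Ap-sum⊆A (inr#inr b#b′) = inj₂ (_ , refl , proj₁ (Ap⊆A ℬ b#b′)) , inj₂ (_ , refl , proj₂ (Ap⊆A ℬ b#b′))
    Ap-sum⊆A (inl#inr a∈A b∈A) = inj₁ (_ , refl , a∈A) , inj₂ (_ , refl , b∈A)
    Ap-sum⊆A (inr#inl b∈A a∈A) = inj₂ (_ , refl , b∈A) , inj₁ (_ , refl , a∈A)

    Ap-sum⇒≢ : ∀ {x y n} → Ap-sum x y n → ¬ x ≡ y
    Ap-sum⇒≢ (inl#inl a#a′) e = irrefl 𝒜 _ _ (subst (λ a′ → Ap 𝒜 _ a′ _) (sym (inl-injective e)) a#a′)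
    Ap-sum⇒≢ (inr#inr b#b′) e = irrefl ℬ _ _ (subst (λ b′ → Ap ℬ _ b′ _) (sym (inr-injective e)) b#b′)
    Ap-sum⇒≢ (inl#inr _ _)  e = inl≢inr consistent e
    Ap-sum⇒≢ (inr#inl _ _)  e = inl≢inr consistent (sym e)

    left : El (TC ⇒ T 𝒜)
    left = case · I · (k · proj₁ (A-inh 𝒜))

    right : El (TC ⇒ T ℬ)
    right = case · (k · proj₁ (A-inh ℬ)) · I

    left-inl : ∀ a → left · (inl · a) ≡ a
    left-inl a = trans (inl-eq _ _ a) (I-eq a)

    right-inr : ∀ b → right · (inr · b) ≡ b
    right-inr b = trans (inr-eq _ _ b) (I-eq b)

    σ-sum : El (TC ⇒ TC ⇒ TC⁻ ⇒ TC⁻)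
    σ-sum = ⟦ Λ₃ (⌜ pair ⌝ $ (⌜ σ[ 𝒜 ] ⌝ $ (⌜ left ⌝ $ v2) $ (⌜ left ⌝ $ v1) $ (⌜ fst ⌝ $ v0))
                           $ (⌜ σ[ ℬ ] ⌝ $ (⌜ right ⌝ $ v2) $ (⌜ right ⌝ $ v1) $ (⌜ snd ⌝ $ v0))) ⟧ tt

    σ-sum-fst : ∀ x y n → fst · (σ-sum · x · y · n) ≡ σ[ 𝒜 ] · (left · x) · (left · y) · (fst · n)
    σ-sum-fst x y n = trans (cong (fst ·_) (Λ₃-β _ tt x y n)) (fst-eq _ _)

    σ-sum-snd : ∀ x y n → snd · (σ-sum · x · y · n) ≡ σ[ ℬ ] · (right · x) · (right · y) · (snd · n)
    σ-sum-snd x y n = trans (cong (snd ·_) (Λ₃-β _ tt x y n)) (snd-eq _ _)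

    σ-sum-sym : ∀ x y n → Ap-sum x y n → Ap-sum y x (σ-sum · x · y · n)
    σ-sum-sym _ _ n (inl#inl a#a′) = inl#inl (subst (Ap 𝒜 _ _)
      (sym (trans (σ-sum-fst _ _ n) (cong₂ (λ a a′ → σ[ 𝒜 ] · a · a′ · _) (left-inl _) (left-inl _))))
      (#-sym 𝒜 a#a′))
    σ-sum-sym _ _ n (inr#inr b#b′) = inr#inr (subst (Ap ℬ _ _)
      (sym (trans (σ-sum-snd _ _ n) (cong₂ (λ b b′ → σ[ ℬ ] · b · b′ · _) (right-inr _) (right-inr _))))
      (#-sym ℬ b#b′))
    σ-sum-sym _ _ _ (inl#inr a∈A b∈A) = inr#inl b∈A a∈A
    σ-sum-sym _ _ _ (inr#inl b∈A a∈A) = inl#inr a∈A b∈A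

    -- Case on z, then on x, then on y: only when all three lie in the same summand is the
    -- cotransitivity of that summand needed.
    τ-sum : El (TC ⇒ TC ⇒ TC ⇒ TC⁻ ⇒ (TC⁻ +ᵗ TC⁻))
    τ-sum = ⟦ Λ₄ (caseᵗ
      (caseᵗ (caseᵗ (mapᵗ (⌜ pair ⌝ $ v0 $ ⌜ T⁻-inh ℬ ⌝) (⌜ pair ⌝ $ v0 $ ⌜ T⁻-inh ℬ ⌝)
                          (⌜ τ[ 𝒜 ] ⌝ $ v1 $ v0 $ v2 $ (⌜ fst ⌝ $ v3)))
                    (⌜ inr ⌝ $ v3) v4)
             (⌜ inl ⌝ $ v2) v4)
      (caseᵗ (⌜ inl ⌝ $ v2)
             (caseᵗ (⌜ inr ⌝ $ v3)
                    (mapᵗ (⌜ pair ⌝ $ ⌜ T⁻-inh 𝒜 ⌝ $ v0) (⌜ pair ⌝ $ ⌜ T⁻-inh 𝒜 ⌝ $ v0)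
                          (⌜ τ[ ℬ ] ⌝ $ v1 $ v0 $ v2 $ (⌜ snd ⌝ $ v3)))
                    v4)
             v4)
      v1) ⟧ tt

    τ-sum-cotrans : ∀ x y z n → Ap-sum x y n → A-sum z →
                    Tagged (τ-sum · x · y · z · n) (Ap-sum x z) (Ap-sum y z)
    τ-sum-cotrans _ _ _ n (inl#inl a#a′) (inj₁ (_ , refl , a″∈A)) =
      Tagged-≡ (trans (Λ₄-β _ tt _ _ _ n) (trans caseᵗ-inl (trans caseᵗ-inl caseᵗ-inl)))
        (mapᵗ-tagged (#-cotrans 𝒜 _ a#a′ a″∈A)
          (λ _ → inl#inl ∘ subst (Ap 𝒜 _ _) (sym (fst-eq _ _)))
          (λ _ → inl#inl ∘ subst (Ap 𝒜 _ _) (sym (fst-eq _ _))))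
    τ-sum-cotrans _ _ _ n (inr#inr b#b′) (inj₂ (_ , refl , b″∈A)) =
      Tagged-≡ (trans (Λ₄-β _ tt _ _ _ n) (trans caseᵗ-inr (trans caseᵗ-inr caseᵗ-inr)))
        (mapᵗ-tagged (#-cotrans ℬ _ b#b′ b″∈A)
          (λ _ → inr#inr ∘ subst (Ap ℬ _ _) (sym (snd-eq _ _)))
          (λ _ → inr#inr ∘ subst (Ap ℬ _ _) (sym (snd-eq _ _))))
    τ-sum-cotrans _ _ _ n (inl#inl a#a′) (inj₂ (_ , refl , b″∈A)) =
      inj₁ (n , trans (Λ₄-β _ tt _ _ _ n) (trans caseᵗ-inr caseᵗ-inl) , inl#inr (proj₁ (Ap⊆A 𝒜 a#a′)) b″∈A)
    τ-sum-cotrans _ _ _ n (inr#inr b#b′) (inj₁ (_ , refl , a″∈A)) =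
      inj₁ (n , trans (Λ₄-β _ tt _ _ _ n) (trans caseᵗ-inl caseᵗ-inr) , inr#inl (proj₁ (Ap⊆A ℬ b#b′)) a″∈A)
    τ-sum-cotrans _ _ _ n (inl#inr _ b′∈A) (inj₁ (_ , refl , a″∈A)) =
      inj₂ (n , trans (Λ₄-β _ tt _ _ _ n) (trans caseᵗ-inl (trans caseᵗ-inl caseᵗ-inr)) , inr#inl b′∈A a″∈A)
    τ-sum-cotrans _ _ _ n (inl#inr a∈A _) (inj₂ (_ , refl , b″∈A)) =
      inj₁ (n , trans (Λ₄-β _ tt _ _ _ n) (trans caseᵗ-inr caseᵗ-inl) , inl#inr a∈A b″∈A)
    τ-sum-cotrans _ _ _ n (inr#inl b∈A _) (inj₁ (_ , refl , a″∈A)) =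
      inj₁ (n , trans (Λ₄-β _ tt _ _ _ n) (trans caseᵗ-inl caseᵗ-inr) , inr#inl b∈A a″∈A)
    τ-sum-cotrans _ _ _ n (inr#inl _ a′∈A) (inj₂ (_ , refl , b″∈A)) =
      inj₂ (n , trans (Λ₄-β _ tt _ _ _ n) (trans caseᵗ-inr (trans caseᵗ-inr caseᵗ-inl)) , inl#inr a′∈A b″∈A)

    𝒜+ℬ : ApType
    𝒜+ℬ = record
      { T = TC ; T⁻ = TC⁻ ; T⁻-inh = pair · T⁻-inh 𝒜 · T⁻-inh ℬ
      ; A = A-sum ; A-inh = inl · proj₁ (A-inh 𝒜) , inj₁ (_ , refl , proj₂ (A-inh 𝒜))
      ; Ap = Ap-sum ; Ap⊆A = Ap-sum⊆A
      ; irrefl = λ _ _ x#x → Ap-sum⇒≢ x#x refl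
      ; symm = σ-sum , σ-sum-sym
      ; cotrans = τ-sum , τ-sum-cotrans }

    inl-reflects : ∀ {x y n a a′} → Ap-sum x y n → x ≡ inl · a → y ≡ inl · a′ → Ap 𝒜 a a′ (fst · n)
    inl-reflects (inl#inl a#a′) e e′ = Ap-≡ 𝒜 (inl-injective e) (inl-injective e′) refl a#a′
    inl-reflects (inr#inr _)    e _  = ⊥-elim (inl≢inr consistent (sym e))
    inl-reflects (inl#inr _ _)  _ e′ = ⊥-elim (inl≢inr consistent (sym e′))
    inl-reflects (inr#inl _ _)  e _  = ⊥-elim (inl≢inr consistent (sym e))

    inr-reflects : ∀ {x y n b b′} → Ap-sum x y n → x ≡ inr · b → y ≡ inr · b′ → Ap ℬ b b′ (snd · n)
    inr-reflects (inr#inr b#b′) e e′ = Ap-≡ ℬ (inr-injective e) (inr-injective e′) refl b#b′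
    inr-reflects (inl#inl _)    e _  = ⊥-elim (inl≢inr consistent e)
    inr-reflects (inl#inr _ _)  e _  = ⊥-elim (inl≢inr consistent e)
    inr-reflects (inr#inl _ _)  _ e′ = ⊥-elim (inl≢inr consistent e′)

    i₁ᴾ : Premor 𝒜 𝒜+ℬ
    i₁ᴾ = premor inl (⟦ Λ₃ (⌜ fst ⌝ $ v0) ⟧ tt) record
      { preserves = λ a a∈A → inj₁ (a , refl , a∈A)
      ; reflects  = λ a a′ n _ _ ia#ia′ →
          subst (Ap 𝒜 a a′) (sym (Λ₃-β _ tt a a′ n)) (inl-reflects ia#ia′ refl refl) }

    i₂ᴾ : Premor ℬ 𝒜+ℬ
    i₂ᴾ = premor inr (⟦ Λ₃ (⌜ snd ⌝ $ v0) ⟧ tt) record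
      { preserves = λ b b∈A → inj₂ (b , refl , b∈A)
      ; reflects  = λ b b′ n _ _ ib#ib′ →
          subst (Ap ℬ b b′) (sym (Λ₃-β _ tt b b′ n)) (inr-reflects ib#ib′ refl refl) }

    module Copairing {𝒳 : ApType} (f : Premor 𝒜 𝒳) (g : Premor ℬ 𝒳) where
      copaired : El (TC ⇒ T 𝒳)
      copaired = case · (fst · mor f) · (fst · mor g)

      copaired-inl : ∀ a → copaired · (inl · a) ≡ f ⟨$⟩ a
      copaired-inl = inl-eq _ _

      copaired-inr : ∀ b → copaired · (inr · b) ≡ g ⟨$⟩ b
      copaired-inr = inr-eq _ _

      copaired-reflect : El (TC ⇒ TC ⇒ T⁻ 𝒳 ⇒ TC⁻)
      copaired-reflect =
        ⟦ Λ₃ (⌜ pair ⌝ $ (⌜ snd · mor f ⌝ $ (⌜ left ⌝ $ v2) $ (⌜ left ⌝ $ v1) $ v0)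
                       $ (⌜ snd · mor g ⌝ $ (⌜ right ⌝ $ v2) $ (⌜ right ⌝ $ v1) $ v0)) ⟧ tt

      copaired-reflect-inl : ∀ a a′ m →
        fst · (copaired-reflect · (inl · a) · (inl · a′) · m) ≡ snd · mor f · a · a′ · m
      copaired-reflect-inl a a′ m =
        trans (cong (fst ·_) (Λ₃-β _ tt _ _ m))
          (trans (fst-eq _ _) (cong₂ (λ u v → snd · mor f · u · v · m) (left-inl a) (left-inl a′)))

      copaired-reflect-inr : ∀ b b′ m →
        snd · (copaired-reflect · (inr · b) · (inr · b′) · m) ≡ snd · mor g · b · b′ · m
      copaired-reflect-inr b b′ m =
        trans (cong (snd ·_) (Λ₃-β _ tt _ _ m))
          (trans (snd-eq _ _) (cong₂ (λ u v → snd · mor g · u · v · m) (right-inr b) (right-inr b′)))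

      copaired-isPremor : IsPremor 𝒜+ℬ 𝒳 copaired copaired-reflect
      copaired-isPremor = record
        { preserves = λ where
            _ (inj₁ (a , refl , a∈A)) → subst (A 𝒳) (sym (copaired-inl a)) (pres f a a∈A)
            _ (inj₂ (b , refl , b∈A)) → subst (A 𝒳) (sym (copaired-inr b)) (pres g b b∈A)
        ; reflects = λ where
            _ _ m (inj₁ (a , refl , a∈A)) (inj₁ (a′ , refl , a′∈A)) fa#fa′ →
              inl#inl (subst (Ap 𝒜 a a′) (sym (copaired-reflect-inl a a′ m))
                (refl# f a a′ m a∈A a′∈A (Ap-≡ 𝒳 (copaired-inl a) (copaired-inl a′) refl fa#fa′)))
            _ _ m (inj₂ (b , refl , b∈A)) (inj₂ (b′ , refl , b′∈A)) gb#gb′ →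
              inr#inr (subst (Ap ℬ b b′) (sym (copaired-reflect-inr b b′ m))
                (refl# g b b′ m b∈A b′∈A (Ap-≡ 𝒳 (copaired-inr b) (copaired-inr b′) refl gb#gb′)))
            _ _ _ (inj₁ (_ , refl , a∈A)) (inj₂ (_ , refl , b∈A)) _ → inl#inr a∈A b∈A
            _ _ _ (inj₂ (_ , refl , b∈A)) (inj₁ (_ , refl , a∈A)) _ → inr#inl b∈A a∈A }

      [_,_]ᴾ : Premor 𝒜+ℬ 𝒳
      [_,_]ᴾ = premor copaired copaired-reflect copaired-isPremor

    open Copairing using ([_,_]ᴾ)

    ∘i₁-⟨$⟩ : ∀ {𝒳} (h : Premor 𝒜+ℬ 𝒳) a → (h ∘ᴾ i₁ᴾ) ⟨$⟩ a ≡ h ⟨$⟩ (inl · a)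
    ∘i₁-⟨$⟩ h a = trans (∘-⟨$⟩ h i₁ᴾ a) (cong (h ⟨$⟩_) (fst-pair· _ _ a))

    ∘i₂-⟨$⟩ : ∀ {𝒳} (h : Premor 𝒜+ℬ 𝒳) b → (h ∘ᴾ i₂ᴾ) ⟨$⟩ b ≡ h ⟨$⟩ (inr · b)
    ∘i₂-⟨$⟩ h b = trans (∘-⟨$⟩ h i₂ᴾ b) (cong (h ⟨$⟩_) (fst-pair· _ _ b))

    coproduct : Coproduct (ApCat 𝒯) 𝒜 ℬ
    coproduct = record
      { A+B = 𝒜+ℬ ; i₁ = i₁ᴾ ; i₂ = i₂ᴾ ; [_,_] = [_,_]ᴾ
      ; i₁-β = λ f g → ≡⇒≈ᴾ ([ f , g ]ᴾ ∘ᴾ i₁ᴾ) f λ a _ →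
          trans (∘i₁-⟨$⟩ [ f , g ]ᴾ a) (trans (fst-pair· _ _ _) (Copairing.copaired-inl f g a))
      ; i₂-β = λ f g → ≡⇒≈ᴾ ([ f , g ]ᴾ ∘ᴾ i₂ᴾ) g λ b _ →
          trans (∘i₂-⟨$⟩ [ f , g ]ᴾ b) (trans (fst-pair· _ _ _) (Copairing.copaired-inr f g b))
      ; unique = unique }
      where
      unique : ∀ {𝒳} (f : Premor 𝒜 𝒳) (g : Premor ℬ 𝒳) (h : Premor 𝒜+ℬ 𝒳) →
               (h ∘ᴾ i₁ᴾ) ≈ᴾ f → (h ∘ᴾ i₂ᴾ) ≈ᴾ g → h ≈ᴾ [ f , g ]ᴾ
      unique {𝒳} f g h hi₁≈f _ _ (inj₁ (a , refl , a∈A)) =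
        subst₂ (_∼_ 𝒳) (∘i₁-⟨$⟩ h a) (sym (trans (fst-pair· _ _ _) (Copairing.copaired-inl f g a)))
          (hi₁≈f a a∈A)
      unique {𝒳} f g h _ hi₂≈g _ (inj₂ (b , refl , b∈A)) =
        subst₂ (_∼_ 𝒳) (∘i₂-⟨$⟩ h b) (sym (trans (fst-pair· _ _ _) (Copairing.copaired-inr f g b)))
          (hi₂≈g b b∈A)

mainTheorem9 : (𝒯 : TCA) → Consistent 𝒯 →
    IsCategory (ApCat 𝒯)
    × Σ (CartesianClosed (ApCat 𝒯)) (λ ccc →
        WellPointed (ApCat 𝒯) (CartesianClosed.terminal ccc)
        × NNO (ApCat 𝒯) (CartesianClosed.terminal ccc)
        × BinaryCoproducts (ApCat 𝒯)
        × WeakInitial (ApCat 𝒯))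
mainTheorem9 𝒯 consistent =
  apIsCategory , cartesianClosed , wellPointed , Naturals.nno consistent
  , Coproducts.coproduct consistent , weakInitial
  where open ApTypeCategory 𝒯
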